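{- Let $V_0,V_1,\dots$ be indeterminates and let $\mathbf{b}=(b_i)_{i\ge0}$, $\boldsymbol{\lambda}=(\lambda_i)_{i\ge1}$ be given by $b_i=-V_i^{ -1}$ and $\lambda_i=V_i^{ -1}V_{i-1}^{ -1}$. For all integers $k\ge1$, $n\ge1$ and $0\le r,s\le 3k$, \[ \mu^{\le 3k}_{ -n,r,s}(\mathbf{b},\boldsymbol{\lambda})=(-1)^{\lfloor (r+1)/3\rfloor+\lfloor (s+1)/3\rfloor+n}\frac{V_0\cdots V_s}{V_0\cdots V_{r-1}}\sum_{\pi\in\widetilde{\mathrm{PV}}^{3,3k}_{n-1,r,s}}\mathrm{wt}(\pi), \] where $V_0\cdots V_{r-1}=1$ if $r=0$.
   Context: A Motzkin path is a finite sequence of points in $\mathbb{Z}\times\mathbb{Z}_{\ge0}$ whose steps are each $(1,1)$, $(1,0)$ or $(1,-1)$; its weight is the product of $b_i$ over horizontal steps starting at height $i$ and $\lambda_i$ over down steps starting at height $i$. $\mu^{\le K}_{N,r,s}(\mathbf{b},\boldsymbol{\lambda})$ ($N\ge0$) is the sum of weights of Motzkin paths from $(0,r)$ to $(N,s)$ staying weakly below $y=K$. If $(f_N)_{N\ge0}$ satisfies $f_N=c_1f_{N-1}+\cdots+c_df_{N-d}$ for all $N\ge d$ with $c_d\ne0$, it is extended uniquely to all $N\in\mathbb{Z}$ so the recurrence holds for all $N$; $\mu^{\le K}_{ -N,r,s}$ denotes this extension (it exists here). $\mathrm{wt}((a_1,\dots,a_N))=V_{a_1}\cdots V_{a_N}$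 (empty sequence: $1$). A modified $(3,r,s)$-peak-valley sequence is a sequence $(a_1,\dots,a_N)$ of nonnegative integers such that, setting $a_0=r$ and $a_{N+1}=s$, for each $i=0,\dots,N+1$: if $a_i\equiv1\pmod3$ then $a_{i-1}>a_i<a_{i+1}$, and if $a_i\equiv2\pmod3$ then $a_{i-1}<a_i>a_{i+1}$, where inequalities involving $a_{ -1}$ or $a_{N+2}$ are ignored. $\widetilde{\mathrm{PV}}^{3,K}_{N,r,s}$ is the set of such sequences with $0\le a_i\le K$ for all $i$. -}

module Defs where

open import Level using (Level; _⊔_)
open import Data.Nat as ℕ using (ℕ; zero; suc; _∸_; _%_; _/_)
import Data.Nat.Properties as ℕP
open import Data.Bool using (Bool; true; false; _∧_; _∨_; not; if_then_else_)
open import Data.List using (List; []; _∷_; map; concatMap; upTo; filterᵇ; foldr; length; _++_; [_])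
open import Data.Maybe using (Maybe; just; nothing)
open import Data.Integer as ℤ using (ℤ)
open import Data.Product using (Σ; _×_; ∃; _,_)
open import Relation.Nullary using (¬_; does)
open import Algebra.Bundles using (CommutativeRing)

record Field (c ℓ : Level) : Set (Level.suc (c ⊔ ℓ)) where
  field
    commRing : CommutativeRing c ℓ
  open CommutativeRing commRing
  field
    1≉0 : ¬ (1# ≈ 0#)
    inverse : ∀ x → ¬ (x ≈ 0#) → Σ Carrier (λ y → x * y ≈ 1#)

infix 4 _==_ _<ᵇ_

_==_ : ℕ → ℕ → Bool
m == n = does (m ℕ.≟ n)

_<ᵇ_ : ℕ → ℕ → Bool
m <ᵇ n = does (m ℕ.<? n)

seqs : ℕ → ℕ → List (List ℕ)
seqs K zero    = [] ∷ []
seqs K (suc m) = concatMap (λ a → map (a ∷_) (seqs K m)) (upTo (suc K))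

-- Motzkin paths, given by their list of heights (h₀, …, h_N).

isStep : ℕ → ℕ → Bool
isStep a b = (b == suc a) ∨ (b == a) ∨ (suc b == a)

allSteps : List ℕ → Bool
allSteps []           = true
allSteps (a ∷ [])     = true
allSteps (a ∷ b ∷ hs) = isStep a b ∧ allSteps (b ∷ hs)

headIs : ℕ → List ℕ → Bool
headIs r []      = false
headIs r (h ∷ _) = h == r

lastIs : ℕ → List ℕ → Bool
lastIs s []           = false
lastIs s (h ∷ [])     = h == s
lastIs s (h ∷ h' ∷ t) = lastIs s (h' ∷ t)

-- Motzkin paths from (0,r) to (N,s) with all heights in [0,K]
-- (heights are natural numbers, so the path stays weakly above y = 0)
motzkinPaths : (K N r s : ℕ) → List (List ℕ)
motzkinPaths K N r s =
  filterᵇ (λ hs → headIs r hs ∧ lastIs s hs ∧ allSteps hs) (seqs K (suc N))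

leftGt : Maybe ℕ → ℕ → Bool
leftGt nothing  x = true
leftGt (just p) x = x <ᵇ p

leftLt : Maybe ℕ → ℕ → Bool
leftLt nothing  x = true
leftLt (just p) x = p <ᵇ x

rightGt : ℕ → List ℕ → Bool
rightGt x []      = true
rightGt x (q ∷ _) = x <ᵇ q

rightLt : ℕ → List ℕ → Bool
rightLt x []      = true
rightLt x (q ∷ _) = q <ᵇ x

pvAt : Maybe ℕ → ℕ → List ℕ → Bool
pvAt p x rest =
  (not (x % 3 == 1) ∨ (leftGt p x ∧ rightGt x rest)) ∧
  (not (x % 3 == 2) ∨ (leftLt p x ∧ rightLt x rest))

pvAll : Maybe ℕ → List ℕ → Bool
pvAll p []         = true
pvAll p (x ∷ rest) = pvAt p x rest ∧ pvAll (just x) rest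

isModPV : (r s : ℕ) → List ℕ → Bool
isModPV r s as = pvAll nothing (r ∷ (as ++ [ s ]))

modPV : (K N r s : ℕ) → List (List ℕ)
modPV K N r s = filterᵇ (isModPV r s) (seqs K N)

module Over {c ℓ} (R : CommutativeRing c ℓ) where
  open CommutativeRing R

  sumR : List Carrier → Carrier
  sumR = foldr _+_ 0#

  prodR : List Carrier → Carrier
  prodR = foldr _*_ 1#

  sign : ℕ → Carrier
  sign zero    = 1#
  sign (suc m) = - sign m

  stepWt : (b : ℕ → Carrier) (λ' : ℕ → Carrier) → ℕ → ℕ → Carrier
  stepWt b λ' x y =
    if y == x then b x else (if suc y == x then λ' x else 1#)

  pathWt : (b : ℕ → Carrier) (λ' : ℕ → Carrier) → List ℕ → Carrier
  pathWt b λ' []           = 1#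
  pathWt b λ' (x ∷ [])     = 1#
  pathWt b λ' (x ∷ y ∷ hs) = stepWt b λ' x y * pathWt b λ' (y ∷ hs)

  mu : (K : ℕ) (b : ℕ → Carrier) (λ' : ℕ → Carrier) (N r s : ℕ) → Carrier
  mu K b λ' N r s = sumR (map (pathWt b λ') (motzkinPaths K N r s))

  recSum : (f : ℤ → Carrier) (cs : ℕ → Carrier) (N : ℤ) (d : ℕ) → Carrier
  recSum f cs N zero    = 0#
  recSum f cs N (suc j) = recSum f cs N j + cs (suc j) * f (N ℤ.- ℤ.+ (suc j))

  SatisfiesRecurrence : (ℤ → Carrier) → Set (c ⊔ ℓ)
  SatisfiesRecurrence f =
    Σ ℕ λ d → Σ (ℕ → Carrier) λ cs →
      (1 ℕ.≤ d) × ¬ (cs d ≈ 0#) × (∀ (N : ℤ) → f N ≈ recSum f cs N d)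

  IsExtension : (ℕ → Carrier) → (ℤ → Carrier) → Set (c ⊔ ℓ)
  IsExtension f g = (∀ (N : ℕ) → g (ℤ.+ N) ≈ f N) × SatisfiesRecurrence g

  wt : (V : ℕ → Carrier) → List ℕ → Carrier
  wt V as = prodR (map V as)

  prodUpTo : (V : ℕ → Carrier) → ℕ → Carrier
  prodUpTo V m = prodR (map V (upTo m))

module Submission where

-- The weighted Motzkin path sums are the entries μ_{N,r,s} = (J^N)_{r,s} of the tridiagonal
-- transfer matrix J on {0, …, 3k}.  For the weights b_i = -1/V_i, λ_i = 1/(V_i V_{i-1}) this
-- matrix is invertible: J⁻¹ has entry ±(V_0⋯V_y)/(V_0⋯V_{x-1}) at (x, y) when y may follow x in
-- a modified peak–valley sequence and 0 otherwise, and J J⁻¹ = J⁻¹ J = 1 reduces to a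
-- cancellation of three signed terms that depends only on residues mod 3.  So N ↦ J^N, N ∈ ℤ,
-- extends μ, and the entries of J^{-n} are the signed peak–valley sums of the statement.  This
-- extension satisfies a linear recurrence: the orthogonal polynomial P of degree 3k + 1 of J
-- annihilates J^N e₀ (Cayley–Hamilton via the three-term recurrence), hence every J^N e_s, and
-- its constant term is ±1/(V_0⋯V_{3k}), a unit.  Run backwards, a recurrence with invertible
-- last coefficient determines a sequence from its values on ℕ, so every extension agrees with it.

open import Defs
open import Data.Nat as ℕ using (ℕ; suc; _≤_; _∸_)
open import Data.Integer as ℤ using (ℤ)
open import Data.Product using (Σ; _×_)
open import Data.List using (map)
open import Algebra.Bundles using (CommutativeRing)

open import Algebra.Bundles using (CommutativeMonoid)
open import Data.Nat using (zero; _<_; z≤n; s≤s; _%_; _/_)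
import Data.Nat.Properties as ℕP
import Data.Integer.Properties as ℤP
open import Data.Bool using (Bool; true; false; _∧_; _∨_; not; if_then_else_)
import Data.Bool.Properties as BoolP
open import Data.List using (List; []; _∷_; _++_; filterᵇ; concatMap; upTo; applyUpTo; [_])
open import Data.List.Properties using (filter-++)
open import Data.Maybe using (Maybe; just; nothing)
open import Data.Product using (_,_; proj₁; proj₂)
open import Data.Empty using (⊥-elim)
open import Function using (_∘_)
open import Relation.Nullary using (¬_; yes; no)
open import Relation.Nullary.Decidable using (T?; dec-true; dec-false)
open import Relation.Binary.Definitions using (tri<; tri≈; tri>)
import Relation.Binary.PropositionalEquality as ≡
open ≡ using (_≡_; _≢_)
open import Algebra.Properties.CommutativeSemigroup (CommutativeMonoid.commutativeSemigroup BoolP.∧-commutativeMonoid)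
  using () renaming (interchange to ∧-interchange; x∙yz≈y∙xz to ∧-x∙yz≈y∙xz)

==-refl : ∀ n → (n == n) ≡ true
==-refl n = dec-true (n ℕ.≟ n) ≡.refl

==-≢ : ∀ {m n} → m ≢ n → (m == n) ≡ false
==-≢ {m} {n} = dec-false (m ℕ.≟ n)

==⇒≡ : ∀ m n → (m == n) ≡ true → m ≡ n
==⇒≡ zero    zero    _  = ≡.refl
==⇒≡ (suc m) (suc n) eq = ≡.cong suc (==⇒≡ m n eq)

==-sym : ∀ m n → (m == n) ≡ (n == m)
==-sym zero    zero    = ≡.refl
==-sym zero    (suc n) = ≡.refl
==-sym (suc m) zero    = ≡.refl
==-sym (suc m) (suc n) = ==-sym m n

<ᵇ-< : ∀ {m n} → m < n → (m <ᵇ n) ≡ true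
<ᵇ-< {m} {n} = dec-true (m ℕ.<? n)

<ᵇ-≮ : ∀ {m n} → ¬ (m < n) → (m <ᵇ n) ≡ false
<ᵇ-≮ {m} {n} = dec-false (m ℕ.<? n)

module FiniteSums {c ℓ} (R : CommutativeRing c ℓ) where
  open CommutativeRing R
  open Over R
  open import Relation.Binary.Reasoning.Setoid setoid
  open import Algebra.Properties.Ring ring
    using (-‿distribˡ-*; -‿distribʳ-*; -‿involutive; -0#≈0#; -‿+-comm) public

  ≡⇒≈ : ∀ {x y} → x ≡ y → x ≈ y
  ≡⇒≈ ≡.refl = refl

  ∑ : ℕ → (ℕ → Carrier) → Carrier
  ∑ zero    f = 0#
  ∑ (suc m) f = f 0 + ∑ m (f ∘ suc)

  ∑-cong : ∀ m {f g : ℕ → Carrier} → (∀ i → i < m → f i ≈ g i) → ∑ m f ≈ ∑ m g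
  ∑-cong zero    f≈g = refl
  ∑-cong (suc m) f≈g = +-cong (f≈g 0 (s≤s z≤n)) (∑-cong m (λ i i<m → f≈g (suc i) (s≤s i<m)))

  ∑-cong′ : ∀ m {f g : ℕ → Carrier} → (∀ i → f i ≈ g i) → ∑ m f ≈ ∑ m g
  ∑-cong′ m f≈g = ∑-cong m (λ i _ → f≈g i)

  ∑-zero : ∀ m {f : ℕ → Carrier} → (∀ i → i < m → f i ≈ 0#) → ∑ m f ≈ 0#
  ∑-zero zero    f≈0 = refl
  ∑-zero (suc m) f≈0 =
    trans (+-cong (f≈0 0 (s≤s z≤n)) (∑-zero m (λ i i<m → f≈0 (suc i) (s≤s i<m)))) (+-identityˡ 0#)

  ∑-+ : ∀ m (f g : ℕ → Carrier) → ∑ m (λ i → f i + g i) ≈ ∑ m f + ∑ m g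
  ∑-+ zero    f g = sym (+-identityˡ 0#)
  ∑-+ (suc m) f g = trans (+-congˡ (∑-+ m (f ∘ suc) (g ∘ suc))) (interchange _ _ _ _)
    where open import Algebra.Properties.CommutativeSemigroup +-commutativeSemigroup using (interchange)

  *-distribˡ-∑ : ∀ m a (f : ℕ → Carrier) → a * ∑ m f ≈ ∑ m (λ i → a * f i)
  *-distribˡ-∑ zero    a f = zeroʳ a
  *-distribˡ-∑ (suc m) a f = trans (distribˡ a _ _) (+-congˡ (*-distribˡ-∑ m a (f ∘ suc)))

  *-distribʳ-∑ : ∀ m a (f : ℕ → Carrier) → ∑ m f * a ≈ ∑ m (λ i → f i * a)
  *-distribʳ-∑ zero    a f = zeroˡ a
  *-distribʳ-∑ (suc m) a f = trans (distribʳ a _ _) (+-congˡ (*-distribʳ-∑ m a (f ∘ suc)))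

  ∑-swap : ∀ m n (f : ℕ → ℕ → Carrier) → ∑ m (λ i → ∑ n (f i)) ≈ ∑ n (λ j → ∑ m (λ i → f i j))
  ∑-swap zero    n f = sym (∑-zero n (λ _ _ → refl))
  ∑-swap (suc m) n f = trans (+-congˡ (∑-swap m n (f ∘ suc))) (sym (∑-+ n (f 0) _))

  ∑-last : ∀ m (f : ℕ → Carrier) → ∑ (suc m) f ≈ ∑ m f + f m
  ∑-last zero    f = +-comm _ _
  ∑-last (suc m) f = trans (+-congˡ (∑-last m (f ∘ suc))) (sym (+-assoc _ _ _))

  ∑-single : ∀ m c (f : ℕ → Carrier) → c < m → (∀ i → i < m → i ≢ c → f i ≈ 0#) → ∑ m f ≈ f c
  ∑-single (suc m) zero    f _ f≈0 =
    trans (+-congˡ (∑-zero m (λ i i<m → f≈0 (suc i) (s≤s i<m) (λ ())))) (+-identityʳ _)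
  ∑-single (suc m) (suc c) f (s≤s c<m) f≈0 =
    trans (+-cong (f≈0 0 (s≤s z≤n) (λ ()))
                  (∑-single m c (f ∘ suc) c<m (λ i i<m i≢c → f≈0 (suc i) (s≤s i<m) (i≢c ∘ ℕP.suc-injective))))
          (+-identityˡ _)

  sumR-upTo : ∀ m (f : ℕ → Carrier) → sumR (map f (upTo m)) ≈ ∑ m f
  sumR-upTo m f = ≡⇒≈ (go m (λ i → i))
    where
    go : ∀ m (g : ℕ → ℕ) → sumR (map f (applyUpTo g m)) ≡ ∑ m (f ∘ g)
    go zero    g = ≡.refl
    go (suc m) g = ≡.cong (f (g 0) +_) (go m (g ∘ suc))

  infix 9 [_]·_
  [_]·_ : Bool → Carrier → Carrier
  [ t ]· x = if t then x else 0#

  δ : ℕ → ℕ → Carrier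
  δ m n = [ m == n ]· 1#

  []·-cong : ∀ t {x y} → x ≈ y → [ t ]· x ≈ [ t ]· y
  []·-cong true  x≈y = x≈y
  []·-cong false x≈y = refl

  *-[]· : ∀ t a x → a * [ t ]· x ≈ [ t ]· (a * x)
  *-[]· true  a x = refl
  *-[]· false a x = zeroʳ a

  []·-* : ∀ t a x → [ t ]· x * a ≈ [ t ]· (x * a)
  []·-* true  a x = refl
  []·-* false a x = zeroˡ a

  δ-refl : ∀ n → δ n n ≈ 1#
  δ-refl n = ≡⇒≈ (≡.cong ([_]· 1#) (==-refl n))

  δ-≢ : ∀ {m n} → m ≢ n → δ m n ≈ 0#
  δ-≢ m≢n = ≡⇒≈ (≡.cong ([_]· 1#) (==-≢ m≢n))

  δ-sym : ∀ m n → δ m n ≈ δ n m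
  δ-sym m n = ≡⇒≈ (≡.cong ([_]· 1#) (==-sym m n))

  ∑-δ : ∀ m c (f : ℕ → Carrier) → c < m → ∑ m (λ a → δ a c * f a) ≈ f c
  ∑-δ m c f c<m = trans (∑-single m c _ c<m (λ a _ a≢c → trans (*-congʳ (δ-≢ a≢c)) (zeroˡ _)))
                        (trans (*-congʳ (δ-refl c)) (*-identityˡ _))

  δ-subst : ∀ m n (f : ℕ → Carrier) → δ m n * f m ≈ δ m n * f n
  δ-subst m n f with m ℕ.≟ n
  ... | yes ≡.refl = refl
  ... | no  m≢n    = trans (*-congʳ (δ-≢ m≢n)) (trans (zeroˡ _) (sym (trans (*-congʳ (δ-≢ m≢n)) (zeroˡ _))))

  ∑-δ-out : ∀ m c (f : ℕ → Carrier) → ¬ (c < m) → ∑ m (λ a → δ a c * f a) ≈ 0#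
  ∑-δ-out m c f c≮m =
    ∑-zero m (λ a a<m → trans (*-congʳ (δ-≢ {a} {c} (λ a≡c → c≮m (≡.subst (_< m) a≡c a<m)))) (zeroˡ (f a)))

  ∑-δ-[] : ∀ m c (f : ℕ → Carrier) → ∑ m (λ a → δ a c * f a) ≈ [ c <ᵇ m ]· f c
  ∑-δ-[] m c f with c ℕ.<? m
  ... | yes c<m = trans (∑-δ m c f c<m) (≡⇒≈ (≡.cong ([_]· f c) (≡.sym (<ᵇ-< c<m))))
  ... | no  c≮m = trans (∑-δ-out m c f c≮m) (≡⇒≈ (≡.cong ([_]· f c) (≡.sym (<ᵇ-≮ c≮m))))

  sign-+ : ∀ m n → sign (m ℕ.+ n) ≈ sign m * sign n
  sign-+ zero    n = sym (*-identityˡ _)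
  sign-+ (suc m) n = trans (-‿cong (sign-+ m n)) (-‿distribˡ-* _ _)

  sign-*-sign : ∀ m → sign m * sign m ≈ 1#
  sign-*-sign zero    = *-identityˡ 1#
  sign-*-sign (suc m) = trans (sym (-‿distribˡ-* _ _))
                              (trans (-‿cong (sym (-‿distribʳ-* _ _))) (trans (-‿involutive _) (sign-*-sign m)))

  sign-+-double : ∀ m n → sign (m ℕ.+ n ℕ.+ n) ≈ sign m
  sign-+-double m n = begin
    sign (m ℕ.+ n ℕ.+ n)        ≈⟨ trans (sign-+ (m ℕ.+ n) n) (*-congʳ (sign-+ m n)) ⟩
    sign m * sign n * sign n    ≈⟨ *-assoc _ _ _ ⟩
    sign m * (sign n * sign n)  ≈⟨ trans (*-congˡ (sign-*-sign n)) (*-identityʳ _) ⟩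
    sign m                      ∎

  ∏ : ℕ → (ℕ → Carrier) → Carrier
  ∏ zero    f = 1#
  ∏ (suc m) f = f 0 * ∏ m (f ∘ suc)

  prodUpTo≡∏ : ∀ (V : ℕ → Carrier) m → prodUpTo V m ≡ ∏ m V
  prodUpTo≡∏ V m = go m (λ i → i)
    where
    go : ∀ m (g : ℕ → ℕ) → prodR (map V (applyUpTo g m)) ≡ ∏ m (V ∘ g)
    go zero    g = ≡.refl
    go (suc m) g = ≡.cong (V (g 0) *_) (go m (g ∘ suc))

  ∏-last : ∀ m (f : ℕ → Carrier) → ∏ (suc m) f ≈ ∏ m f * f m
  ∏-last zero    f = *-comm _ _
  ∏-last (suc m) f = trans (*-congˡ (∏-last m (f ∘ suc))) (sym (*-assoc _ _ _))

  PointwiseInverse : (ℕ → Carrier) → (ℕ → Carrier) → Set ℓ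
  PointwiseInverse f g = ∀ i → f i * g i ≈ 1#

  ∏-inverse : ∀ m (f g : ℕ → Carrier) → PointwiseInverse f g → ∏ m f * ∏ m g ≈ 1#
  ∏-inverse zero    f g fg = *-identityˡ 1#
  ∏-inverse (suc m) f g fg = begin
    (f 0 * ∏ m (f ∘ suc)) * (g 0 * ∏ m (g ∘ suc)) ≈⟨ interchange (f 0) _ (g 0) _ ⟩
    (f 0 * g 0) * (∏ m (f ∘ suc) * ∏ m (g ∘ suc)) ≈⟨ *-cong (fg 0) (∏-inverse m _ _ (fg ∘ suc)) ⟩
    1# * 1#                                       ≈⟨ *-identityˡ 1# ⟩
    1#                                            ∎
    where open import Algebra.Properties.CommutativeSemigroup *-commutativeSemigroup using (interchange)

  module _ {A : Set} where

    sumR-++ : ∀ (w : A → Carrier) xs ys → sumR (map w (xs ++ ys)) ≈ sumR (map w xs) + sumR (map w ys)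
    sumR-++ w []       ys = sym (+-identityˡ _)
    sumR-++ w (x ∷ xs) ys = trans (+-congˡ (sumR-++ w xs ys)) (sym (+-assoc _ _ _))

    *-distribˡ-sumR : ∀ a (w : A → Carrier) xs → a * sumR (map w xs) ≈ sumR (map (λ x → a * w x) xs)
    *-distribˡ-sumR a w []       = zeroʳ a
    *-distribˡ-sumR a w (x ∷ xs) = trans (distribˡ a _ _) (+-congˡ (*-distribˡ-sumR a w xs))

    sumR-filter-cong : ∀ (w : A → Carrier) {p q : A → Bool} → (∀ x → p x ≡ q x) → ∀ xs →
                       sumR (map w (filterᵇ p xs)) ≈ sumR (map w (filterᵇ q xs))
    sumR-filter-cong w {p} {q} p≗q xs = ≡⇒≈ (≡.cong (sumR ∘ map w) (go xs))
      where
      go : ∀ xs → filterᵇ p xs ≡ filterᵇ q xs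
      go []       = ≡.refl
      go (x ∷ xs) with p x | q x | p≗q x
      ... | true  | true  | _ = ≡.cong (x ∷_) (go xs)
      ... | false | false | _ = go xs

    sumR-filter-∧ : ∀ (w : A → Carrier) t (q : A → Bool) xs →
                    sumR (map w (filterᵇ (λ x → t ∧ q x) xs)) ≈ [ t ]· sumR (map w (filterᵇ q xs))
    sumR-filter-∧ w true  q xs       = refl
    sumR-filter-∧ w false q []       = refl
    sumR-filter-∧ w false q (x ∷ xs) = sumR-filter-∧ w false q xs

    sumR-filter-concatMap : ∀ (w : A → Carrier) (p : A → Bool) (F : ℕ → List A) ns →
      sumR (map w (filterᵇ p (concatMap F ns))) ≈ sumR (map (λ n → sumR (map w (filterᵇ p (F n)))) ns)
    sumR-filter-concatMap w p F []       = refl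
    sumR-filter-concatMap w p F (n ∷ ns) =
      trans (≡⇒≈ (≡.cong (sumR ∘ map w) (filter-++ (T? ∘ p) (F n) (concatMap F ns))))
            (trans (sumR-++ w (filterᵇ p (F n)) _) (+-congˡ (sumR-filter-concatMap w p F ns)))

  sumR-filter-cons : ∀ (w : List ℕ → Carrier) (p : List ℕ → Bool) a xss →
    sumR (map w (filterᵇ p (map (a ∷_) xss))) ≡ sumR (map (w ∘ (a ∷_)) (filterᵇ (p ∘ (a ∷_)) xss))
  sumR-filter-cons w p a []         = ≡.refl
  sumR-filter-cons w p a (xs ∷ xss) with p (a ∷ xs)
  ... | true  = ≡.cong (w (a ∷ xs) +_) (sumR-filter-cons w p a xss)
  ... | false = sumR-filter-cons w p a xss

  sumR-seqs-suc : ∀ K m (w : List ℕ → Carrier) (p : List ℕ → Bool) →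
    sumR (map w (filterᵇ p (seqs K (suc m))))
      ≈ ∑ (suc K) (λ a → sumR (map (w ∘ (a ∷_)) (filterᵇ (p ∘ (a ∷_)) (seqs K m))))
  sumR-seqs-suc K m w p = begin
    sumR (map w (filterᵇ p (seqs K (suc m))))
      ≈⟨ sumR-filter-concatMap w p (λ a → map (a ∷_) (seqs K m)) (upTo (suc K)) ⟩
    sumR (map (λ a → sumR (map w (filterᵇ p (map (a ∷_) (seqs K m))))) (upTo (suc K)))
      ≈⟨ sumR-upTo (suc K) _ ⟩
    ∑ (suc K) (λ a → sumR (map w (filterᵇ p (map (a ∷_) (seqs K m)))))
      ≈⟨ ∑-cong′ (suc K) (λ a → ≡⇒≈ (sumR-filter-cons w p a (seqs K m))) ⟩
    ∑ (suc K) (λ a → sumR (map (w ∘ (a ∷_)) (filterᵇ (p ∘ (a ∷_)) (seqs K m)))) ∎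

private
  module Arithmetic where
    open import Data.Integer.Tactic.RingSolver using (solve-∀)
    open import Data.Nat.Tactic.RingSolver using () renaming (solve-∀ to ℕ-solve-∀)

    exponents : ∀ p q t n → suc (p ℕ.+ q) ℕ.+ (q ℕ.+ t ℕ.+ suc n) ≡ p ℕ.+ t ℕ.+ suc (suc n) ℕ.+ q ℕ.+ q
    exponents = ℕ-solve-∀

    sub-sub-comm : ∀ N a b → N ℤ.- a ℤ.- b ≡ N ℤ.- b ℤ.- a
    sub-sub-comm = solve-∀

    +-+-sub : ∀ M a b → M ℤ.+ (a ℤ.+ b) ℤ.- a ≡ M ℤ.+ b
    +-+-sub = solve-∀

    +-sub-suc : ∀ M d → M ℤ.+ d ℤ.- (ℤ.1ℤ ℤ.+ d) ≡ ℤ.-1ℤ ℤ.+ M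
    +-sub-suc = solve-∀

    pred-sub : ∀ M m → ℤ.-1ℤ ℤ.+ (M ℤ.- m) ≡ M ℤ.- (ℤ.1ℤ ℤ.+ m)
    pred-sub = solve-∀

    +-sub-cancel : ∀ N M → N ≡ M ℤ.+ (N ℤ.- M)
    +-sub-cancel = solve-∀

    sub-+-cancel : ∀ N a → N ≡ (N ℤ.- a) ℤ.+ a
    sub-+-cancel = solve-∀

    +-+-comm : ∀ N a b → N ℤ.+ a ℤ.+ b ≡ N ℤ.+ b ℤ.+ a
    +-+-comm = solve-∀

    +-suc : ∀ N i → N ℤ.+ (ℤ.1ℤ ℤ.+ i) ≡ ℤ.1ℤ ℤ.+ N ℤ.+ i
    +-suc = solve-∀

    pred-+-suc : ∀ M u → ℤ.-1ℤ ℤ.+ M ℤ.+ (ℤ.1ℤ ℤ.+ u) ≡ M ℤ.+ u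
    pred-+-suc = solve-∀

    sub-suc-+-suc : ∀ N d i → N ℤ.- (ℤ.1ℤ ℤ.+ d) ℤ.+ (ℤ.1ℤ ℤ.+ i) ≡ N ℤ.- d ℤ.+ i
    sub-suc-+-suc = solve-∀

  pos-sub : ∀ {m n} → n ≤ m → ℤ.+ m ℤ.- ℤ.+ n ≡ ℤ.+ (m ∸ n)
  pos-sub {m} {n} n≤m = ≡.trans (ℤP.m-n≡m⊖n m n) (ℤP.⊖-≥ n≤m)

open Arithmetic

-- Matrices on {0, …, D-1} and ℤ-indexed orbits

module Matrices {c ℓ} (R : CommutativeRing c ℓ) (D : ℕ) where
  open CommutativeRing R
  open FiniteSums R
  open import Relation.Binary.Reasoning.Setoid setoid
  open import Algebra.Properties.CommutativeSemigroup *-commutativeSemigroup using (x∙yz≈y∙xz)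

  Vector : Set c
  Vector = ℕ → Carrier

  Matrix : Set c
  Matrix = ℕ → ℕ → Carrier

  infix 4 _≋_
  _≋_ : Vector → Vector → Set ℓ
  v ≋ w = ∀ r → r < D → v r ≈ w r

  infixr 7 _·_
  _·_ : Matrix → Vector → Vector
  (A · v) r = ∑ D (λ h → A r h * v h)

  unit : ℕ → Vector
  unit s h = δ h s

  ·-cong : ∀ A {v w} → v ≋ w → A · v ≋ A · w
  ·-cong A v≋w r _ = ∑-cong D (λ h h<D → *-congˡ (v≋w h h<D))

  ·-scale : ∀ A a v r → (A · (λ h → a * v h)) r ≈ a * (A · v) r
  ·-scale A a v r = trans (∑-cong′ D (λ h → x∙yz≈y∙xz (A r h) a (v h))) (sym (*-distribˡ-∑ D a _))

  ·-zero : ∀ A r → (A · (λ _ → 0#)) r ≈ 0#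
  ·-zero A r = ∑-zero D (λ h _ → zeroʳ (A r h))

  ·-unit : ∀ A s r → s < D → (A · unit s) r ≈ A r s
  ·-unit A s r s<D = trans (∑-cong′ D (λ h → *-comm (A r h) (δ h s))) (∑-δ D s (A r) s<D)

  IsInverse : Matrix → Matrix → Set ℓ
  IsInverse A B = ∀ x y → x < D → y < D → ∑ D (λ a → A x a * B a y) ≈ δ x y

  ·-inverse : ∀ {A B} → IsInverse A B → ∀ v → A · B · v ≋ v
  ·-inverse {A} {B} AB v r r<D = begin
    ∑ D (λ h → A r h * ∑ D (λ a → B h a * v a))
      ≈⟨ ∑-cong′ D (λ h → *-distribˡ-∑ D (A r h) _) ⟩
    ∑ D (λ h → ∑ D (λ a → A r h * (B h a * v a)))
      ≈⟨ ∑-swap D D _ ⟩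
    ∑ D (λ a → ∑ D (λ h → A r h * (B h a * v a)))
      ≈⟨ ∑-cong′ D (λ a → trans (∑-cong′ D (λ h → sym (*-assoc _ _ _))) (sym (*-distribʳ-∑ D (v a) _))) ⟩
    ∑ D (λ a → ∑ D (λ h → A r h * B h a) * v a)
      ≈⟨ ∑-cong D (λ a a<D → *-congʳ (trans (AB r a r<D a<D) (δ-sym r a))) ⟩
    ∑ D (λ a → δ a r * v a)
      ≈⟨ ∑-δ D r v r<D ⟩
    v r ∎

  infixr 7 _^_·_
  _^_·_ : Matrix → ℕ → Vector → Vector
  A ^ zero  · v = v
  A ^ suc N · v = A · A ^ N · v

  -- A^N v for N ∈ ℤ, with B in the role of A⁻¹
  zpow : Matrix → Matrix → Vector → ℤ → Vector
  zpow A B v (ℤ.+ N)    = A ^ N · v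
  zpow A B v ℤ.-[1+ n ] = B ^ suc n · v

  Orbit : Matrix → Matrix → (ℤ → Vector) → Set ℓ
  Orbit A B z = ∀ N → (z (ℤ.suc N) ≋ A · z N) × (z (ℤ.pred N) ≋ B · z N)

  zpow-orbit : ∀ {A B} → IsInverse A B → IsInverse B A → ∀ v → Orbit A B (zpow A B v)
  zpow-orbit {A} {B} AB BA v (ℤ.+ N) = (λ r _ → refl) , pred-pos N
    where
    pred-pos : ∀ N → zpow A B v (ℤ.pred (ℤ.+ N)) ≋ B · zpow A B v (ℤ.+ N)
    pred-pos zero    r _   = refl
    pred-pos (suc N) r r<D = sym (·-inverse BA _ r r<D)
  zpow-orbit AB BA v ℤ.-[1+ zero ]  = (λ r r<D → sym (·-inverse AB v r r<D)) , (λ r _ → refl)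
  zpow-orbit AB BA v ℤ.-[1+ suc n ] = (λ r r<D → sym (·-inverse AB _ r r<D)) , (λ r _ → refl)

  module _ {A B : Matrix} where

    orbit-unique : ∀ {z z′} → Orbit A B z → Orbit A B z′ → z (ℤ.+ 0) ≋ z′ (ℤ.+ 0) → ∀ N → z N ≋ z′ N
    orbit-unique {z} {z′} oz oz′ z₀≋z′₀ = go
      where
      pos : ∀ N → z (ℤ.+ N) ≋ z′ (ℤ.+ N)
      pos zero    = z₀≋z′₀
      pos (suc N) r r<D = trans (proj₁ (oz (ℤ.+ N)) r r<D)
                                (trans (·-cong A (pos N) r r<D) (sym (proj₁ (oz′ (ℤ.+ N)) r r<D)))
      neg : ∀ n → z ℤ.-[1+ n ] ≋ z′ ℤ.-[1+ n ]
      neg zero    r r<D = trans (proj₂ (oz (ℤ.+ 0)) r r<D)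
                                (trans (·-cong B (pos 0) r r<D) (sym (proj₂ (oz′ (ℤ.+ 0)) r r<D)))
      neg (suc n) r r<D = trans (proj₂ (oz ℤ.-[1+ n ]) r r<D)
                                (trans (·-cong B (neg n) r r<D) (sym (proj₂ (oz′ ℤ.-[1+ n ]) r r<D)))
      go : ∀ N → z N ≋ z′ N
      go (ℤ.+ N)    = pos N
      go ℤ.-[1+ n ] = neg n

    orbit-scale : ∀ a {z} → Orbit A B z → Orbit A B (λ N h → a * z N h)
    orbit-scale a oz N = (λ r r<D → trans (*-congˡ (proj₁ (oz N) r r<D)) (sym (·-scale A a _ r)))
                       , (λ r r<D → trans (*-congˡ (proj₂ (oz N) r r<D)) (sym (·-scale B a _ r)))

    orbit-zero : Orbit A B (λ _ _ → 0#)
    orbit-zero N = (λ r _ → sym (·-zero A r)) , (λ r _ → sym (·-zero B r))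

  -- p(E) z for p = p₀ + p₁ X + ⋯ + p_{m-1} X^{m-1} and the shift (E z) N = z (N + 1)
  applyPoly : ℕ → (ℕ → Carrier) → (ℤ → Vector) → ℤ → Vector
  applyPoly m p z N r = ∑ m (λ i → p i * z (N ℤ.+ ℤ.+ i) r)

  applyPoly-cong : ∀ m p {z z′ : ℤ → Vector} N r → (∀ M → z M r ≈ z′ M r) →
                   applyPoly m p z N r ≈ applyPoly m p z′ N r
  applyPoly-cong m p N r z≈z′ = ∑-cong′ m (λ i → *-congˡ (z≈z′ _))

  applyPoly-scale : ∀ m p a (z : ℤ → Vector) N r →
                    applyPoly m p (λ M h → a * z M h) N r ≈ a * applyPoly m p z N r
  applyPoly-scale m p a z N r =
    trans (∑-cong′ m (λ i → x∙yz≈y∙xz (p i) a _)) (sym (*-distribˡ-∑ m a _))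

  applyPoly-comm : ∀ m m′ p q (z : ℤ → Vector) N r →
                   applyPoly m p (applyPoly m′ q z) N r ≈ applyPoly m′ q (applyPoly m p z) N r
  applyPoly-comm m m′ p q z N r = begin
    ∑ m (λ i → p i * ∑ m′ (λ j → q j * z (N ℤ.+ ℤ.+ i ℤ.+ ℤ.+ j) r))
      ≈⟨ ∑-cong′ m (λ i → *-distribˡ-∑ m′ (p i) _) ⟩
    ∑ m (λ i → ∑ m′ (λ j → p i * (q j * z (N ℤ.+ ℤ.+ i ℤ.+ ℤ.+ j) r)))
      ≈⟨ ∑-swap m m′ _ ⟩
    ∑ m′ (λ j → ∑ m (λ i → p i * (q j * z (N ℤ.+ ℤ.+ i ℤ.+ ℤ.+ j) r)))
      ≈⟨ ∑-cong′ m′ (λ j → ∑-cong′ m (λ i → trans (x∙yz≈y∙xz (p i) (q j) _)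
                   (*-congˡ (*-congˡ (≡⇒≈ (≡.cong (λ M → z M r) (+-+-comm N (ℤ.+ i) (ℤ.+ j)))))))) ⟩
    ∑ m′ (λ j → ∑ m (λ i → q j * (p i * z (N ℤ.+ ℤ.+ j ℤ.+ ℤ.+ i) r)))
      ≈⟨ ∑-cong′ m′ (λ j → sym (*-distribˡ-∑ m (q j) _)) ⟩
    ∑ m′ (λ j → q j * ∑ m (λ i → p i * z (N ℤ.+ ℤ.+ j ℤ.+ ℤ.+ i) r)) ∎

  applyPoly-orbit : ∀ m p {A B z} → Orbit A B z → Orbit A B (applyPoly m p z)
  applyPoly-orbit m p {A} {B} {z} oz N =
    commute ℤ.suc (λ M i → ℤP.+-assoc ℤ.1ℤ M i) A (proj₁ ∘ oz) ,
    commute ℤ.pred (λ M i → ℤP.+-assoc ℤ.-1ℤ M i) B (proj₂ ∘ oz)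
    where
    commute : (φ : ℤ → ℤ) → (∀ M i → φ M ℤ.+ i ≡ φ (M ℤ.+ i)) → ∀ C → (∀ M → z (φ M) ≋ C · z M) →
              applyPoly m p z (φ N) ≋ C · applyPoly m p z N
    commute φ φ-+ C step r r<D = begin
      ∑ m (λ i → p i * z (φ N ℤ.+ ℤ.+ i) r)
        ≈⟨ ∑-cong′ m (λ i → *-congˡ (trans (≡⇒≈ (≡.cong (λ M → z M r) (φ-+ N (ℤ.+ i))))
                                           (step (N ℤ.+ ℤ.+ i) r r<D))) ⟩
      ∑ m (λ i → p i * ∑ D (λ h → C r h * z (N ℤ.+ ℤ.+ i) h))
        ≈⟨ ∑-cong′ m (λ i → trans (*-distribˡ-∑ D (p i) _) (∑-cong′ D (λ h → x∙yz≈y∙xz (p i) (C r h) _))) ⟩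
      ∑ m (λ i → ∑ D (λ h → C r h * (p i * z (N ℤ.+ ℤ.+ i) h)))
        ≈⟨ ∑-swap m D _ ⟩
      ∑ D (λ h → ∑ m (λ i → C r h * (p i * z (N ℤ.+ ℤ.+ i) h)))
        ≈⟨ ∑-cong′ D (λ h → sym (*-distribˡ-∑ m (C r h) _)) ⟩
      (C · applyPoly m p z N) r ∎

-- Linear recurrences on ℤ

module Recurrences {c ℓ} (R : CommutativeRing c ℓ) where
  open CommutativeRing R
  open Over R
  open FiniteSums R
  open import Relation.Binary.Reasoning.Setoid setoid
  open import Algebra.Properties.Group +-group using (x∙y⁻¹≈ε⇒x≈y; x≈y⇒x∙y⁻¹≈ε; inverseʳ-unique)
  open import Algebra.Properties.CommutativeSemigroup +-commutativeSemigroup using (interchange)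
  open import Algebra.Properties.CommutativeSemigroup *-commutativeSemigroup using (x∙yz≈y∙xz)

  Recurrent : (ℕ → Carrier) → ℕ → (ℤ → Carrier) → Set ℓ
  Recurrent cs d h = ∀ N → h N ≈ recSum h cs N d

  module _ (cs : ℕ → Carrier) where

    recSum-0 : ∀ d N → recSum (λ _ → 0#) cs N d ≈ 0#
    recSum-0 zero    N = refl
    recSum-0 (suc d) N = trans (+-cong (recSum-0 d N) (zeroʳ _)) (+-identityʳ 0#)

    recSum-cong : ∀ d {h h′ : ℤ → Carrier} N → (∀ t → t < d → h (N ℤ.- ℤ.+ suc t) ≈ h′ (N ℤ.- ℤ.+ suc t)) →
                  recSum h cs N d ≈ recSum h′ cs N d
    recSum-cong zero    N h≈h′ = refl
    recSum-cong (suc d) N h≈h′ =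
      +-cong (recSum-cong d N (λ t t<d → h≈h′ t (ℕP.m<n⇒m<1+n t<d))) (*-congˡ (h≈h′ d (ℕP.n<1+n d)))

    recSum-+ : ∀ d (h h′ : ℤ → Carrier) N →
               recSum (λ M → h M + h′ M) cs N d ≈ recSum h cs N d + recSum h′ cs N d
    recSum-+ zero    h h′ N = sym (+-identityʳ 0#)
    recSum-+ (suc d) h h′ N = trans (+-cong (recSum-+ d h h′ N) (distribˡ _ _ _)) (interchange _ _ _ _)

    recSum-scale : ∀ d a (h : ℤ → Carrier) N → recSum (λ M → a * h M) cs N d ≈ a * recSum h cs N d
    recSum-scale zero    a h N = sym (zeroʳ a)
    recSum-scale (suc d) a h N =
      trans (+-cong (recSum-scale d a h N) (x∙yz≈y∙xz _ _ _)) (sym (distribˡ a _ _))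

    recSum-neg : ∀ d (h : ℤ → Carrier) N → recSum (λ M → - h M) cs N d ≈ - recSum h cs N d
    recSum-neg zero    h N = sym -0#≈0#
    recSum-neg (suc d) h N = trans (+-cong (recSum-neg d h N) (sym (-‿distribʳ-* _ _))) (-‿+-comm _ _)

    recSum-shift : ∀ d (h : ℤ → Carrier) a N → recSum (λ M → h (M ℤ.- a)) cs N d ≈ recSum h cs (N ℤ.- a) d
    recSum-shift zero    h a N = refl
    recSum-shift (suc d) h a N =
      +-cong (recSum-shift d h a N) (*-congˡ (≡⇒≈ (≡.cong h (sub-sub-comm N (ℤ.+ suc d) a))))

  recSum-swap : ∀ (h : ℤ → Carrier) cs cs′ d d′ N →
                recSum (λ M → recSum h cs′ M d′) cs N d ≈ recSum (λ M → recSum h cs M d) cs′ N d′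
  recSum-swap h cs cs′ zero    d′ N = sym (recSum-0 cs′ d′ N)
  recSum-swap h cs cs′ (suc d) d′ N = sym (begin
    recSum (λ M → recSum h cs M d + cs (suc d) * h (M ℤ.- ℤ.+ suc d)) cs′ N d′
      ≈⟨ recSum-+ cs′ d′ _ _ N ⟩
    recSum (λ M → recSum h cs M d) cs′ N d′ + recSum (λ M → cs (suc d) * h (M ℤ.- ℤ.+ suc d)) cs′ N d′
      ≈⟨ +-cong (sym (recSum-swap h cs cs′ d d′ N))
                (trans (recSum-scale cs′ d′ (cs (suc d)) _ N) (*-congˡ (recSum-shift cs′ d′ h (ℤ.+ suc d) N))) ⟩
    recSum (λ M → recSum h cs′ M d′) cs N d + cs (suc d) * recSum h cs′ (N ℤ.- ℤ.+ suc d) d′ ∎)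

  recurrent-recSum : ∀ {cs d h} cs′ d′ → Recurrent cs d h → Recurrent cs d (λ M → recSum h cs′ M d′)
  recurrent-recSum {cs} {d} {h} cs′ d′ rec N = begin
    recSum h cs′ N d′                                   ≈⟨ recSum-cong cs′ d′ N (λ t _ → rec _) ⟩
    recSum (λ M → recSum h cs M d) cs′ N d′             ≈⟨ recSum-swap h cs′ cs d′ d N ⟩
    recSum (λ M → recSum h cs′ M d′) cs N d             ∎

  recurrent-sub : ∀ {cs d g h} → Recurrent cs d g → Recurrent cs d h → Recurrent cs d (λ M → g M + - h M)
  recurrent-sub {cs} {d} {g} {h} recg rech N = sym (begin
    recSum (λ M → g M + - h M) cs N d           ≈⟨ recSum-+ cs d g _ N ⟩
    recSum g cs N d + recSum (λ M → - h M) cs N d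
      ≈⟨ +-cong (sym (recg N)) (trans (recSum-neg cs d h N) (-‿cong (sym (rech N)))) ⟩
    g N + - h N                                  ∎)

  -- A recurrence with invertible last coefficient can be run backwards.
  recurrent-vanishing : ∀ {cs d h} y → Recurrent cs (suc d) h → cs (suc d) * y ≈ 1# →
                        ∀ N₀ → (∀ u → h (N₀ ℤ.+ ℤ.+ u) ≈ 0#) → ∀ N → h N ≈ 0#
  recurrent-vanishing {cs} {d} {h} y rec inv N₀ h≈0 N with N ℤ.- N₀ in eq
  ... | ℤ.+ u      = trans (≡⇒≈ (≡.cong h (≡.trans (+-sub-cancel N N₀) (≡.cong (λ e → N₀ ℤ.+ e) eq)))) (h≈0 u)
  ... | ℤ.-[1+ u ] =
    trans (≡⇒≈ (≡.cong h (≡.trans (+-sub-cancel N N₀)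
                           (≡.trans (≡.cong (λ e → N₀ ℤ.+ e) eq) (≡.sym (ℤP.+-identityʳ _))))))
          (below (suc u) 0)
    where
    VanishesFrom : ℤ → Set ℓ
    VanishesFrom M = ∀ u → h (M ℤ.+ ℤ.+ u) ≈ 0#

    cancel : ∀ {x} → cs (suc d) * x ≈ 0# → x ≈ 0#
    cancel {x} cx≈0 = begin
      x                     ≈⟨ sym (trans (*-congʳ inv) (*-identityˡ x)) ⟩
      cs (suc d) * y * x    ≈⟨ trans (*-congʳ (*-comm _ _)) (*-assoc _ _ _) ⟩
      y * (cs (suc d) * x)  ≈⟨ trans (*-congˡ cx≈0) (zeroʳ y) ⟩
      0#                    ∎

    step : ∀ M → VanishesFrom M → VanishesFrom (ℤ.pred M)
    step M vM zero    = cancel (begin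
      cs (suc d) * h (ℤ.pred M ℤ.+ ℤ.+ 0)
        ≈⟨ *-congˡ (≡⇒≈ (≡.cong h (≡.trans (ℤP.+-identityʳ _) (≡.sym (+-sub-suc M (ℤ.+ d)))))) ⟩
      cs (suc d) * h (N′ ℤ.- ℤ.+ suc d)
        ≈⟨ sym (+-identityˡ _) ⟩
      0# + cs (suc d) * h (N′ ℤ.- ℤ.+ suc d)
        ≈⟨ +-congʳ (sym (trans (recSum-cong cs d N′ later) (recSum-0 cs d N′))) ⟩
      recSum h cs N′ (suc d)
        ≈⟨ trans (sym (rec N′)) (vM d) ⟩
      0# ∎)
      where
      N′ : ℤ
      N′ = M ℤ.+ ℤ.+ d
      later : ∀ t → t < d → h (N′ ℤ.- ℤ.+ suc t) ≈ 0#
      later t t<d = trans (≡⇒≈ (≡.cong h (≡.trans (≡.cong (λ e → M ℤ.+ e ℤ.- ℤ.+ suc t)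
                                                   (≡.trans (≡.cong ℤ.+_ (≡.sym (ℕP.m+[n∸m]≡n t<d))) (ℤP.pos-+ (suc t) _)))
                                                (+-+-sub M (ℤ.+ suc t) _))))
                          (vM (d ∸ suc t))
    step M vM (suc u) = trans (≡⇒≈ (≡.cong h (pred-+-suc M (ℤ.+ u)))) (vM u)

    below : ∀ m → VanishesFrom (N₀ ℤ.- ℤ.+ m)
    below zero    u = trans (≡⇒≈ (≡.cong h (≡.cong (ℤ._+ ℤ.+ u) (ℤP.+-identityʳ N₀)))) (h≈0 u)
    below (suc m) u = trans (≡⇒≈ (≡.cong (λ M → h (M ℤ.+ ℤ.+ u)) (≡.sym (pred-sub N₀ (ℤ.+ m)))))
                            (step (N₀ ℤ.- ℤ.+ m) (below m) u)

  recSum-cong-coeff : ∀ (h : ℤ → Carrier) {cs cs′} d N → (∀ t → t < d → cs (suc t) ≈ cs′ (suc t)) →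
                      recSum h cs N d ≈ recSum h cs′ N d
  recSum-cong-coeff h zero    N cs≈cs′ = refl
  recSum-cong-coeff h (suc d) N cs≈cs′ =
    +-cong (recSum-cong-coeff h d N (λ t t<d → cs≈cs′ t (ℕP.m<n⇒m<1+n t<d))) (*-congʳ (cs≈cs′ d (ℕP.n<1+n d)))

  recSum-reverse : ∀ d (p : ℕ → Carrier) (h : ℤ → Carrier) N →
    recSum h (λ t → - p (d ∸ t)) N d ≈ - ∑ d (λ i → p i * h (N ℤ.- ℤ.+ d ℤ.+ ℤ.+ i))
  recSum-reverse zero    p h N = sym -0#≈0#
  recSum-reverse (suc d) p h N = begin
    recSum h (λ t → - p (suc d ∸ t)) N d + - p (suc d ∸ suc d) * h (N ℤ.- ℤ.+ suc d)
      ≈⟨ +-cong (recSum-cong-coeff h d N (λ t t<d → -‿cong (≡⇒≈ (≡.cong p (ℕP.+-∸-assoc 1 t<d)))))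
                (*-congʳ (-‿cong (≡⇒≈ (≡.cong p (ℕP.n∸n≡0 d))))) ⟩
    recSum h (λ t → - p (suc (d ∸ t))) N d + - p 0 * h (N ℤ.- ℤ.+ suc d)
      ≈⟨ +-cong (recSum-reverse d (p ∘ suc) h N) (sym (-‿distribˡ-* _ _)) ⟩
    - ∑ d (λ i → p (suc i) * h (N ℤ.- ℤ.+ d ℤ.+ ℤ.+ i)) + - (p 0 * h (N ℤ.- ℤ.+ suc d))
      ≈⟨ trans (-‿+-comm _ _) (-‿cong (+-comm _ _)) ⟩
    - (p 0 * h (N ℤ.- ℤ.+ suc d) + ∑ d (λ i → p (suc i) * h (N ℤ.- ℤ.+ d ℤ.+ ℤ.+ i)))
      ≈⟨ -‿cong (+-cong (*-congˡ (≡⇒≈ (≡.cong h (≡.sym (ℤP.+-identityʳ _)))))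
                        (∑-cong′ d (λ i → *-congˡ (≡⇒≈ (≡.cong h (≡.sym (sub-suc-+-suc N (ℤ.+ d) (ℤ.+ i)))))))) ⟩
    - ∑ (suc d) (λ i → p i * h (N ℤ.- ℤ.+ suc d ℤ.+ ℤ.+ i)) ∎

  annihilated⇒recurrent : ∀ d p h → p d ≈ 1# → (∀ N → ∑ (suc d) (λ i → p i * h (N ℤ.+ ℤ.+ i)) ≈ 0#) →
                          Recurrent (λ t → - p (d ∸ t)) d h
  annihilated⇒recurrent d p h monic annihilated N = begin
    h N                                            ≈⟨ ≡⇒≈ (≡.cong h (sub-+-cancel N (ℤ.+ d))) ⟩
    h (N′ ℤ.+ ℤ.+ d)                               ≈⟨ sym (trans (*-congʳ monic) (*-identityˡ _)) ⟩
    p d * h (N′ ℤ.+ ℤ.+ d)                         ≈⟨ inverseʳ-unique _ _ (trans (sym (∑-last d _)) (annihilated N′)) ⟩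
    - ∑ d (λ i → p i * h (N′ ℤ.+ ℤ.+ i))           ≈⟨ sym (recSum-reverse d p h N) ⟩
    recSum h (λ t → - p (d ∸ t)) N d               ∎
    where
    N′ : ℤ
    N′ = N ℤ.- ℤ.+ d

  -- First g satisfies the recurrence of g′: the difference of the two sides satisfies the
  -- recurrence of g and vanishes from d′ + 1 on.  Then g′ - g satisfies it and vanishes on ℕ.
  extension-unique : ∀ {g g′ cs cs′ d d′} y y′ →
    Recurrent cs (suc d) g → cs (suc d) * y ≈ 1# →
    Recurrent cs′ (suc d′) g′ → cs′ (suc d′) * y′ ≈ 1# →
    (∀ u → g (ℤ.+ u) ≈ g′ (ℤ.+ u)) → ∀ N → g′ N ≈ g N
  extension-unique {g} {g′} {cs} {cs′} {d} {d′} y y′ recg inv recg′ inv′ g≈g′ N =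
    x∙y⁻¹≈ε⇒x≈y _ _ (recurrent-vanishing {cs′} {d′} y′ (recurrent-sub {cs′} {suc d′} recg′ recg-cs′) inv′
                                         (ℤ.+ 0)
                       (λ u → x≈y⇒x∙y⁻¹≈ε (sym (g≈g′ u))) N)
    where
    agree-before : ∀ u t → t < suc d′ →
                   g (ℤ.+ (suc d′ ℕ.+ u) ℤ.- ℤ.+ suc t) ≈ g′ (ℤ.+ (suc d′ ℕ.+ u) ℤ.- ℤ.+ suc t)
    agree-before u t t<d′ rewrite pos-sub (ℕP.≤-trans t<d′ (ℕP.m≤m+n (suc d′) u)) = g≈g′ _
    recg-cs′ : Recurrent cs′ (suc d′) g
    recg-cs′ = λ N → x∙y⁻¹≈ε⇒x≈y _ _ (recurrent-vanishing {cs} {d} y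
      (recurrent-sub {cs} {suc d} recg (recurrent-recSum {cs} {suc d} cs′ (suc d′) recg)) inv (ℤ.+ suc d′)
      (λ u → x≈y⇒x∙y⁻¹≈ε (trans (g≈g′ (suc d′ ℕ.+ u))
                           (trans (recg′ _) (recSum-cong cs′ (suc d′) _ (λ t t<d′ → sym (agree-before u t t<d′))))))
      N)

-- The Jacobi matrix and its orthogonal polynomials

module Jacobi {c ℓ} (R : CommutativeRing c ℓ) (D : ℕ) (b lam : ℕ → CommutativeRing.Carrier R) where
  open CommutativeRing R
  open Over R
  open FiniteSums R
  open Matrices R D public
  open import Relation.Binary.Reasoning.Setoid setoid

  J : Matrix
  J x a = [ isStep x a ]· stepWt b lam x a

  J-entries : ∀ x a → J x a ≈ δ a (suc x) + δ a x * b x + δ (suc a) x * lam x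
  J-entries x a = entries (a == suc x) (a == x) (suc a == x) ≡.refl ≡.refl ≡.refl
    where
    up-excl : a ≡ suc x → a ≢ x × suc a ≢ x
    up-excl ≡.refl = (λ e → ℕP.1+n≢n e) , (λ e → ℕP.<⇒≢ (ℕP.m<n⇒m<1+n (ℕP.n<1+n x)) (≡.sym e))
    entries : ∀ A B C → (a == suc x) ≡ A → (a == x) ≡ B → (suc a == x) ≡ C →
              [ A ∨ B ∨ C ]· (if B then b x else if C then lam x else 1#)
                ≈ [ A ]· 1# + [ B ]· 1# * b x + [ C ]· 1# * lam x
    entries true  true  _     eA eB _  = ⊥-elim (proj₁ (up-excl (==⇒≡ a _ eA)) (==⇒≡ a x eB))
    entries true  false true  eA _  eC = ⊥-elim (proj₂ (up-excl (==⇒≡ a _ eA)) (==⇒≡ (suc a) x eC))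
    entries false true  true  _  eB eC with ≡.refl ← ==⇒≡ a x eB = ⊥-elim (ℕP.1+n≢n (==⇒≡ (suc a) a eC))
    entries true  false false _  _  _  =
      sym (trans (+-congˡ (zeroˡ _)) (trans (+-identityʳ _) (trans (+-congˡ (zeroˡ _)) (+-identityʳ _))))
    entries false true  false _  _  _  =
      sym (trans (+-congˡ (zeroˡ _)) (trans (+-identityʳ _) (trans (+-identityˡ _) (*-identityˡ _))))
    entries false false true  _  _  _  =
      sym (trans (+-cong (trans (+-identityˡ _) (zeroˡ _)) (*-identityˡ _)) (+-identityˡ _))
    entries false false false _  _  _  =
      sym (trans (+-cong (trans (+-identityˡ _) (zeroˡ _)) (zeroˡ _)) (+-identityˡ 0#))

  distrib-entries : ∀ p q r x y f → (p + q * x + r * y) * f ≈ p * f + q * (x * f) + r * (y * f)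
  distrib-entries p q r x y f =
    trans (distribʳ f _ _) (+-cong (trans (distribʳ f _ _) (+-congˡ (*-assoc _ _ _))) (*-assoc _ _ _))

  below : ℕ → Vector → Carrier
  below zero    v = 0#
  below (suc x) v = lam (suc x) * v x

  above : ℕ → Vector → Carrier
  above zero    v = 0#
  above (suc y) v = v y

  J-row : ∀ x v → x < D → (J · v) x ≈ [ suc x <ᵇ D ]· v (suc x) + b x * v x + below x v
  J-row x v x<D = begin
    ∑ D (λ a → J x a * v a)
      ≈⟨ ∑-cong′ D (λ a → trans (*-congʳ (J-entries x a)) (distrib-entries _ _ _ _ _ _)) ⟩
    ∑ D (λ a → δ a (suc x) * v a + δ a x * (b x * v a) + δ (suc a) x * (lam x * v a))
      ≈⟨ trans (∑-+ D _ _) (+-congʳ (∑-+ D _ _)) ⟩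
    ∑ D (λ a → δ a (suc x) * v a) + ∑ D (λ a → δ a x * (b x * v a)) + ∑ D (λ a → δ (suc a) x * (lam x * v a))
      ≈⟨ +-cong (+-cong (∑-δ-[] D (suc x) v) (∑-δ D x _ x<D)) (lower x x<D) ⟩
    [ suc x <ᵇ D ]· v (suc x) + b x * v x + below x v ∎
    where
    lower : ∀ x → x < D → ∑ D (λ a → δ (suc a) x * (lam x * v a)) ≈ below x v
    lower zero    _     = ∑-zero D (λ a _ → zeroˡ _)
    lower (suc x) sx<D = ∑-δ D x (λ a → lam (suc x) * v a) (ℕP.<-trans (ℕP.n<1+n x) sx<D)

  J-column : ∀ y v → y < D → ∑ D (λ a → v a * J a y) ≈ above y v + v y * b y + [ suc y <ᵇ D ]· (v (suc y) * lam (suc y))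
  J-column y v y<D = begin
    ∑ D (λ a → v a * J a y)
      ≈⟨ ∑-cong′ D (λ a → trans (*-comm _ _) (trans (*-congʳ (J-entries a y)) (distrib-entries _ _ _ _ _ _))) ⟩
    ∑ D (λ a → δ y (suc a) * v a + δ y a * (b a * v a) + δ (suc y) a * (lam a * v a))
      ≈⟨ trans (∑-+ D _ _) (+-congʳ (∑-+ D _ _)) ⟩
    ∑ D (λ a → δ y (suc a) * v a) + ∑ D (λ a → δ y a * (b a * v a)) + ∑ D (λ a → δ (suc y) a * (lam a * v a))
      ≈⟨ +-cong (+-cong (upper y y<D)
                        (trans (∑-cong′ D (λ a → *-congʳ (δ-sym y a))) (trans (∑-δ D y _ y<D) (*-comm _ _))))
                (trans (∑-cong′ D (λ a → *-congʳ (δ-sym (suc y) a)))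
                       (trans (∑-δ-[] D (suc y) _) ([]·-cong _ (*-comm _ _)))) ⟩
    above y v + v y * b y + [ suc y <ᵇ D ]· (v (suc y) * lam (suc y)) ∎
    where
    upper : ∀ y → y < D → ∑ D (λ a → δ y (suc a) * v a) ≈ above y v
    upper zero    _     = ∑-zero D (λ a _ → zeroˡ _)
    upper (suc y) sy<D = trans (∑-cong′ D (λ a → *-congʳ (δ-sym y a))) (∑-δ D y v (ℕP.<-trans (ℕP.n<1+n y) sy<D))

  -- coefficient lists; P (suc j) is the orthogonal polynomial of degree j, and P 0 = 0
  shift : (ℕ → Carrier) → ℕ → Carrier
  shift p zero    = 0#
  shift p (suc i) = p i

  P : ℕ → ℕ → Carrier
  P zero          i       = 0#
  P (suc zero)    zero    = 1#
  P (suc zero)    (suc i) = 0#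
  P (suc (suc j)) i       = shift (P (suc j)) i + - b j * P (suc j) i + - lam j * P j i

  P-degree : ∀ j i → j ≤ i → P j i ≈ 0#
  P-degree zero          i       _       = refl
  P-degree (suc zero)    (suc i) _       = refl
  P-degree (suc (suc j)) (suc i) (s≤s j<i) =
    trans (+-cong (+-cong (P-degree (suc j) i j<i) (*-congˡ (P-degree (suc j) (suc i) (ℕP.m≤n⇒m≤1+n j<i))))
                  (*-congˡ (P-degree j (suc i) (ℕP.m≤n⇒m≤1+n (ℕP.<⇒≤ j<i)))))
          (trans (+-cong (trans (+-congˡ (zeroʳ _)) (+-identityʳ 0#)) (zeroʳ _)) (+-identityʳ 0#))

  P-monic : ∀ j → P (suc j) j ≈ 1#
  P-monic zero    = refl
  P-monic (suc j) =
    trans (+-cong (+-cong (P-monic j) (*-congˡ (P-degree (suc j) (suc j) ℕP.≤-refl)))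
                  (*-congˡ (P-degree j (suc j) (ℕP.n≤1+n j))))
          (trans (+-cong (trans (+-congˡ (zeroʳ _)) (+-identityʳ 1#)) (zeroʳ _)) (+-identityʳ 1#))

  applyP : ℕ → (ℤ → Vector) → ℤ → Vector
  applyP j = applyPoly (suc D) (P j)

  applyP-three-term : ∀ j → suc j ≤ D → ∀ z N r →
    applyP (suc (suc j)) z N r ≈ applyP (suc j) z (ℤ.suc N) r + - b j * applyP (suc j) z N r + - lam j * applyP j z N r
  applyP-three-term j sj≤D z N r = begin
    ∑ (suc D) (λ i → (shift f i + - b j * f i + - lam j * g i) * Z i)
      ≈⟨ ∑-cong′ (suc D) (λ i → distrib-entries (shift f i) (- b j) (- lam j) (f i) (g i) (Z i)) ⟩
    ∑ (suc D) (λ i → shift f i * Z i + - b j * (f i * Z i) + - lam j * (g i * Z i))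
      ≈⟨ trans (∑-+ (suc D) (λ i → shift f i * Z i + - b j * (f i * Z i)) (λ i → - lam j * (g i * Z i)))
               (+-cong (∑-+ (suc D) (λ i → shift f i * Z i) (λ i → - b j * (f i * Z i)))
                       (sym (*-distribˡ-∑ (suc D) (- lam j) (λ i → g i * Z i)))) ⟩
    ∑ (suc D) (λ i → shift f i * Z i) + ∑ (suc D) (λ i → - b j * (f i * Z i)) + - lam j * applyP j z N r
      ≈⟨ +-congʳ (+-cong shifted (sym (*-distribˡ-∑ (suc D) (- b j) (λ i → f i * Z i)))) ⟩
    applyP (suc j) z (ℤ.suc N) r + - b j * applyP (suc j) z N r + - lam j * applyP j z N r ∎
    where
    f g : ℕ → Carrier
    f = P (suc j)
    g = P j
    Z : ℕ → Carrier
    Z i = z (N ℤ.+ ℤ.+ i) r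
    shifted : ∑ (suc D) (λ i → shift f i * Z i) ≈ applyP (suc j) z (ℤ.suc N) r
    shifted = begin
      0# * Z 0 + ∑ D (λ i → f i * Z (suc i))
        ≈⟨ trans (+-congʳ (zeroˡ _)) (+-identityˡ _) ⟩
      ∑ D (λ i → f i * Z (suc i))
        ≈⟨ ∑-cong′ D (λ i → *-congˡ (≡⇒≈ (≡.cong (λ M → z M r) (+-suc N (ℤ.+ i))))) ⟩
      ∑ D (λ i → f i * z (ℤ.suc N ℤ.+ ℤ.+ i) r)
        ≈⟨ sym (trans (∑-last D _) (trans (+-congˡ (trans (*-congʳ (P-degree (suc j) D sj≤D)) (zeroˡ _))) (+-identityʳ _))) ⟩
      applyP (suc j) z (ℤ.suc N) r ∎

  -- P (suc j) (J) e₀ = Λ j e_j, so P (suc s) (J) maps the orbit of e₀ to Λ s times that of e_s,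
  -- and P (suc D) (J) e₀ = 0 because e_D lies outside; polynomials in J commute.
  module CayleyHamilton (U : Matrix) (JU : IsInverse J U) (UJ : IsInverse U J)
                        (lam⁻¹ : ℕ → Carrier) (lam⁻¹-inverse : PointwiseInverse lam⁻¹ lam) where
    open Recurrences R using (Recurrent; annihilated⇒recurrent)
    open import Algebra.Solver.CommutativeMonoid +-commutativeMonoid
      using () renaming (solve to +-solve; _⊜_ to _⊜₊_; _⊕_ to _⊕₊_)

    Y : ℕ → ℤ → Vector
    Y s = zpow J U (unit s)

    Λ : ℕ → Carrier
    Λ j = ∏ j (lam ∘ suc)

    Z : ℕ → ℤ → Vector
    Z j = applyP j (Y 0)

    Z-orbit : ∀ j → Orbit J U (Z j)
    Z-orbit j = applyPoly-orbit (suc D) (P j) (zpow-orbit JU UJ (unit 0))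

    Z₀ : ℕ → Vector
    Z₀ zero    r = 0#
    Z₀ (suc j) r = Λ j * δ r j

    Z₀-step : ∀ j r → Λ j * (δ j (suc r) + δ j r * b r + δ (suc j) r * lam r) + - b j * (Λ j * δ r j) + - lam j * Z₀ j r
                      ≈ Λ (suc j) * δ r (suc j)
    Z₀-step j r = begin
      Λ j * (δ j (suc r) + δ j r * b r + δ (suc j) r * lam r) + - b j * (Λ j * δ r j) + - lam j * Z₀ j r
        ≈⟨ +-congʳ (+-congʳ (trans (distribˡ _ _ _) (+-congʳ (distribˡ _ _ _)))) ⟩
      Λ j * δ j (suc r) + Λ j * (δ j r * b r) + Λ j * (δ (suc j) r * lam r) + - b j * (Λ j * δ r j) + - lam j * Z₀ j r
        ≈⟨ +-solve 5 (λ a b c x y → ((((a ⊕₊ b) ⊕₊ c) ⊕₊ x) ⊕₊ y) ⊜₊ (((a ⊕₊ y) ⊕₊ (b ⊕₊ x)) ⊕₊ c))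
                     refl _ _ _ _ _ ⟩
      (Λ j * δ j (suc r) + - lam j * Z₀ j r) + (Λ j * (δ j r * b r) + - b j * (Λ j * δ r j)) + Λ j * (δ (suc j) r * lam r)
        ≈⟨ +-cong (+-cong (down j) diagonal) up ⟩
      0# + 0# + Λ (suc j) * δ r (suc j)
        ≈⟨ trans (+-congʳ (+-identityʳ 0#)) (+-identityˡ _) ⟩
      Λ (suc j) * δ r (suc j) ∎
      where
      open import Algebra.Properties.CommutativeSemigroup *-commutativeSemigroup using (x∙yz≈y∙xz)
      cancel : ∀ {u} a x → u ≈ a * x → u + - a * x ≈ 0#
      cancel a x u≈ax = trans (+-cong u≈ax (sym (-‿distribˡ-* a x))) (-‿inverseʳ _)
      Λ-suc : ∀ j → Λ (suc j) ≈ Λ j * lam (suc j)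
      Λ-suc j = ∏-last j (lam ∘ suc)
      down : ∀ j → Λ j * δ j (suc r) + - lam j * Z₀ j r ≈ 0#
      down zero    = trans (+-cong (zeroʳ _) (zeroʳ _)) (+-identityʳ 0#)
      down (suc j) = cancel _ _ (begin
        Λ (suc j) * δ j r              ≈⟨ trans (*-congʳ (Λ-suc j)) (trans (*-congˡ (δ-sym j r)) (*-assoc _ _ _)) ⟩
        Λ j * (lam (suc j) * δ r j)    ≈⟨ x∙yz≈y∙xz _ _ _ ⟩
        lam (suc j) * (Λ j * δ r j)    ∎)
      diagonal : Λ j * (δ j r * b r) + - b j * (Λ j * δ r j) ≈ 0#
      diagonal = cancel _ _ (begin
        Λ j * (δ j r * b r)    ≈⟨ *-congˡ (trans (sym (δ-subst j r b)) (*-comm _ _)) ⟩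
        Λ j * (b j * δ j r)    ≈⟨ x∙yz≈y∙xz _ _ _ ⟩
        b j * (Λ j * δ j r)    ≈⟨ *-congˡ (*-congˡ (δ-sym j r)) ⟩
        b j * (Λ j * δ r j)    ∎)
      up : Λ j * (δ (suc j) r * lam r) ≈ Λ (suc j) * δ r (suc j)
      up = begin
        Λ j * (δ (suc j) r * lam r)          ≈⟨ *-congˡ (trans (sym (δ-subst (suc j) r lam)) (*-comm _ _)) ⟩
        Λ j * (lam (suc j) * δ (suc j) r)    ≈⟨ sym (*-assoc _ _ _) ⟩
        Λ j * lam (suc j) * δ (suc j) r      ≈⟨ *-cong (sym (Λ-suc j)) (δ-sym (suc j) r) ⟩
        Λ (suc j) * δ r (suc j)              ∎

    Z-initial-step : ∀ j → j < D → Z (suc j) (ℤ.+ 0) ≋ Z₀ (suc j) → Z j (ℤ.+ 0) ≋ Z₀ j →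
                     Z (suc (suc j)) (ℤ.+ 0) ≋ Z₀ (suc (suc j))
    Z-initial-step j j<D Z₁≋ Z₀≋ r r<D = begin
      Z (suc (suc j)) (ℤ.+ 0) r
        ≈⟨ applyP-three-term j j<D (Y 0) (ℤ.+ 0) r ⟩
      Z (suc j) (ℤ.+ 1) r + - b j * Z (suc j) (ℤ.+ 0) r + - lam j * Z j (ℤ.+ 0) r
        ≈⟨ +-cong (+-cong one-step (*-congˡ (Z₁≋ r r<D))) (*-congˡ (Z₀≋ r r<D)) ⟩
      Λ j * (δ j (suc r) + δ j r * b r + δ (suc j) r * lam r) + - b j * (Λ j * δ r j) + - lam j * Z₀ j r
        ≈⟨ Z₀-step j r ⟩
      Λ (suc j) * δ r (suc j) ∎
      where
      one-step : Z (suc j) (ℤ.+ 1) r ≈ Λ j * (δ j (suc r) + δ j r * b r + δ (suc j) r * lam r)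
      one-step = begin
        Z (suc j) (ℤ.+ 1) r                   ≈⟨ proj₁ (Z-orbit (suc j) (ℤ.+ 0)) r r<D ⟩
        (J · Z (suc j) (ℤ.+ 0)) r             ≈⟨ ·-cong J Z₁≋ r r<D ⟩
        (J · (λ h → Λ j * unit j h)) r        ≈⟨ ·-scale J (Λ j) (unit j) r ⟩
        Λ j * (J · unit j) r                  ≈⟨ *-congˡ (trans (·-unit J j r j<D) (J-entries r j)) ⟩
        Λ j * (δ j (suc r) + δ j r * b r + δ (suc j) r * lam r) ∎

    Z-initial : ∀ j → j ≤ suc D → Z j (ℤ.+ 0) ≋ Z₀ j
    Z-initial zero          _         r _ = ∑-zero (suc D) (λ i _ → zeroˡ (Y 0 (ℤ.+ i) r))
    Z-initial (suc zero)    _         r _ =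
      trans (+-cong (*-identityˡ _) (∑-zero D (λ i _ → zeroˡ (Y 0 (ℤ.+ suc i) r))))
            (trans (+-identityʳ _) (sym (*-identityˡ _)))
    Z-initial (suc (suc j)) (s≤s j<D) =
      Z-initial-step j j<D (Z-initial (suc j) (ℕP.m≤n⇒m≤1+n j<D)) (Z-initial j (ℕP.m≤n⇒m≤1+n (ℕP.<⇒≤ j<D)))

    Y-scaled : ∀ s → s < D → ∀ N → (λ r → Λ s * Y s N r) ≋ Z (suc s) N
    Y-scaled s s<D = orbit-unique (orbit-scale (Λ s) (zpow-orbit JU UJ (unit s))) (Z-orbit (suc s))
                       (λ r r<D → sym (Z-initial (suc s) (ℕP.m≤n⇒m≤1+n s<D) r r<D))

    Z-top-vanishes : ∀ N → Z (suc D) N ≋ (λ _ → 0#)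
    Z-top-vanishes = orbit-unique (Z-orbit (suc D)) orbit-zero
      (λ r r<D → trans (Z-initial (suc D) ℕP.≤-refl r r<D) (trans (*-congˡ (δ-≢ (ℕP.<⇒≢ r<D))) (zeroʳ _)))

    P-annihilates : ∀ s → s < D → ∀ N → applyP (suc D) (Y s) N ≋ (λ _ → 0#)
    P-annihilates s s<D N r r<D = begin
      applyP (suc D) (Y s) N r
        ≈⟨ sym (trans (sym (*-assoc _ _ _)) (trans (*-congʳ (∏-inverse s _ _ (lam⁻¹-inverse ∘ suc))) (*-identityˡ _))) ⟩
      Λ⁻¹ * (Λ s * applyP (suc D) (Y s) N r)
        ≈⟨ *-congˡ (sym (applyPoly-scale (suc D) (P (suc D)) (Λ s) (Y s) N r)) ⟩
      Λ⁻¹ * applyP (suc D) (λ M h → Λ s * Y s M h) N r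
        ≈⟨ *-congˡ (applyPoly-cong (suc D) (P (suc D)) {λ M h → Λ s * Y s M h} {Z (suc s)} N r
                                   (λ M → Y-scaled s s<D M r r<D)) ⟩
      Λ⁻¹ * applyP (suc D) (Z (suc s)) N r
        ≈⟨ *-congˡ (applyPoly-comm (suc D) (suc D) (P (suc D)) (P (suc s)) (Y 0) N r) ⟩
      Λ⁻¹ * applyP (suc s) (Z (suc D)) N r
        ≈⟨ *-congˡ (∑-zero (suc D) (λ i _ → trans (*-congˡ (Z-top-vanishes (N ℤ.+ ℤ.+ i) r r<D))
                                                  (zeroʳ (P (suc s) i)))) ⟩
      Λ⁻¹ * 0#
        ≈⟨ zeroʳ _ ⟩
      0# ∎
      where
      Λ⁻¹ : Carrier
      Λ⁻¹ = ∏ s (lam⁻¹ ∘ suc)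

    Y-recurrent : ∀ s r → s < D → r < D → Recurrent (λ t → - P (suc D) (D ∸ t)) D (λ N → Y s N r)
    Y-recurrent s r s<D r<D =
      annihilated⇒recurrent D (P (suc D)) _ (P-monic D) (λ N → P-annihilates s s<D N r r<D)

-- Motzkin paths

module MotzkinPaths {c ℓ} (R : CommutativeRing c ℓ) (K : ℕ) (b lam : ℕ → CommutativeRing.Carrier R) where
  open CommutativeRing R
  open Over R
  open FiniteSums R
  open Jacobi R (suc K) b lam
  open import Relation.Binary.Reasoning.Setoid setoid

  isPath : ℕ → ℕ → List ℕ → Bool
  isPath r s hs = headIs r hs ∧ lastIs s hs ∧ allSteps hs

  isPath-∷ : ∀ r h s xs → isPath r s (r ∷ h ∷ xs) ≡ isStep r h ∧ isPath h s (h ∷ xs)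
  isPath-∷ r h s xs rewrite ==-refl r | ==-refl h = ∧-x∙yz≈y∙xz (lastIs s (h ∷ xs)) (isStep r h) _

  -- paths listed by their heights after the start
  pathsFrom : ℕ → ℕ → ℕ → Carrier
  pathsFrom N r s = sumR (map (pathWt b lam ∘ (r ∷_)) (filterᵇ (isPath r s ∘ (r ∷_)) (seqs K N)))

  mu≈pathsFrom : ∀ N r s → r < suc K → mu K b lam N r s ≈ pathsFrom N r s
  mu≈pathsFrom N r s r<D =
    trans (sumR-seqs-suc K N (pathWt b lam) (isPath r s)) (∑-single (suc K) r _ r<D other-starts)
    where
    other-starts : ∀ a → a < suc K → a ≢ r →
      sumR (map (pathWt b lam ∘ (a ∷_)) (filterᵇ (isPath r s ∘ (a ∷_)) (seqs K N))) ≈ 0#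
    other-starts a _ a≢r rewrite ==-≢ a≢r =
      sumR-filter-∧ (pathWt b lam ∘ (a ∷_)) false (λ xs → lastIs s (a ∷ xs) ∧ allSteps (a ∷ xs)) (seqs K N)

  pathsFrom-zero : ∀ r s → pathsFrom 0 r s ≈ δ r s
  pathsFrom-zero r s rewrite ==-refl r with r == s
  ... | true  = +-identityʳ 1#
  ... | false = refl

  pathsFrom-suc : ∀ N r s → pathsFrom (suc N) r s ≈ (J · (λ h → pathsFrom N h s)) r
  pathsFrom-suc N r s = begin
    pathsFrom (suc N) r s
      ≈⟨ sumR-seqs-suc K N (pathWt b lam ∘ (r ∷_)) (isPath r s ∘ (r ∷_)) ⟩
    ∑ (suc K) (λ h → sumR (map (λ xs → stepWt b lam r h * pathWt b lam (h ∷ xs))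
                               (filterᵇ (λ xs → isPath r s (r ∷ h ∷ xs)) (seqs K N))))
      ≈⟨ ∑-cong′ (suc K) first-step ⟩
    ∑ (suc K) (λ h → J r h * pathsFrom N h s) ∎
    where
    first-step : ∀ h → sumR (map (λ xs → stepWt b lam r h * pathWt b lam (h ∷ xs))
                                (filterᵇ (λ xs → isPath r s (r ∷ h ∷ xs)) (seqs K N)))
                       ≈ J r h * pathsFrom N h s
    first-step h = begin
      sumR (map _ (filterᵇ (λ xs → isPath r s (r ∷ h ∷ xs)) (seqs K N)))
        ≈⟨ sumR-filter-cong _ (isPath-∷ r h s) (seqs K N) ⟩
      sumR (map _ (filterᵇ (λ xs → isStep r h ∧ isPath h s (h ∷ xs)) (seqs K N)))
        ≈⟨ sumR-filter-∧ _ (isStep r h) _ (seqs K N) ⟩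
      [ isStep r h ]· sumR (map (λ xs → stepWt b lam r h * pathWt b lam (h ∷ xs)) (filterᵇ (isPath h s ∘ (h ∷_)) (seqs K N)))
        ≈⟨ []·-cong (isStep r h) (sym (*-distribˡ-sumR (stepWt b lam r h) (pathWt b lam ∘ (h ∷_))
                                                       (filterᵇ (isPath h s ∘ (h ∷_)) (seqs K N)))) ⟩
      [ isStep r h ]· (stepWt b lam r h * pathsFrom N h s)
        ≈⟨ sym ([]·-* (isStep r h) _ _) ⟩
      J r h * pathsFrom N h s ∎

  mu≈J-power : ∀ N r s → r < suc K → mu K b lam N r s ≈ (J ^ N · unit s) r
  mu≈J-power N r s r<D = trans (mu≈pathsFrom N r s r<D) (go N r r<D)
    where
    go : ∀ N → (λ r → pathsFrom N r s) ≋ J ^ N · unit s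
    go zero    r _   = pathsFrom-zero r s
    go (suc N) r r<D = trans (pathsFrom-suc N r s) (·-cong J (go N) r r<D)

-- Peak–valley sequences

pvLeft : Maybe ℕ → ℕ → Bool
pvLeft p x = (not (x % 3 == 1) ∨ leftGt p x) ∧ (not (x % 3 == 2) ∨ leftLt p x)

pvRight : ℕ → List ℕ → Bool
pvRight x rest = (not (x % 3 == 1) ∨ rightGt x rest) ∧ (not (x % 3 == 2) ∨ rightLt x rest)

-- y may directly follow x in a modified peak–valley sequence
pvStep : ℕ → ℕ → Bool
pvStep x y = pvRight x [ y ] ∧ pvLeft (just x) y

pvAt-split : ∀ p x rest → pvAt p x rest ≡ pvLeft p x ∧ pvRight x rest
pvAt-split p x rest =
  ≡.trans (≡.cong₂ _∧_ (BoolP.∨-distribˡ-∧ (not (x % 3 == 1)) (leftGt p x) (rightGt x rest))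
                       (BoolP.∨-distribˡ-∧ (not (x % 3 == 2)) (leftLt p x) (rightLt x rest)))
          (∧-interchange (not (x % 3 == 1) ∨ leftGt p x) _ (not (x % 3 == 2) ∨ leftLt p x) _)

pvChain : ℕ → List ℕ → Bool
pvChain x rest = pvRight x rest ∧ pvAll (just x) rest

pvChain-∷ : ∀ x y rest → pvChain x (y ∷ rest) ≡ pvStep x y ∧ pvChain y rest
pvChain-∷ x y rest rewrite pvAt-split (just x) y rest =
  ≡.trans (≡.cong (pvRight x [ y ] ∧_) (BoolP.∧-assoc (pvLeft (just x) y) _ _))
          (≡.sym (BoolP.∧-assoc (pvRight x [ y ]) _ _))

pvRight-[] : ∀ x → pvRight x [] ≡ true
pvRight-[] x rewrite BoolP.∨-zeroʳ (not (x % 3 == 1)) | BoolP.∨-zeroʳ (not (x % 3 == 2)) = ≡.refl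

pvLeft-nothing : ∀ x → pvLeft nothing x ≡ true
pvLeft-nothing x rewrite BoolP.∨-zeroʳ (not (x % 3 == 1)) | BoolP.∨-zeroʳ (not (x % 3 == 2)) = ≡.refl

isModPV≡pvChain : ∀ r s as → isModPV r s as ≡ pvChain r (as ++ [ s ])
isModPV≡pvChain r s as rewrite pvAt-split nothing r (as ++ [ s ]) | pvLeft-nothing r = ≡.refl

isModPV-[] : ∀ r s → isModPV r s [] ≡ pvStep r s
isModPV-[] r s rewrite isModPV≡pvChain r s [] | pvChain-∷ r s [] | pvRight-[] s = BoolP.∧-identityʳ _

isModPV-∷ : ∀ r s a as → isModPV r s (a ∷ as) ≡ pvStep r a ∧ isModPV a s as
isModPV-∷ r s a as rewrite isModPV≡pvChain r s (a ∷ as) | pvChain-∷ r a (as ++ [ s ]) | isModPV≡pvChain a s as = ≡.refl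

data Mod3 : Set where
  0₃ 1₃ 2₃ : Mod3

next : Mod3 → Mod3
next 0₃ = 1₃
next 1₃ = 2₃
next 2₃ = 0₃

mod3 : ℕ → Mod3
mod3 zero    = 0₃
mod3 (suc n) = next (mod3 n)

toℕ₃ : Mod3 → ℕ
toℕ₃ 0₃ = 0
toℕ₃ 1₃ = 1
toℕ₃ 2₃ = 2

mod3-+3 : ∀ n → mod3 (3 ℕ.+ n) ≡ mod3 n
mod3-+3 n with mod3 n
... | 0₃ = ≡.refl
... | 1₃ = ≡.refl
... | 2₃ = ≡.refl

ind3 : (Q : ℕ → Set) → Q 0 → Q 1 → Q 2 → (∀ n → Q n → Q (3 ℕ.+ n)) → ∀ n → Q n
ind3 Q q₀ q₁ q₂ step zero                = q₀
ind3 Q q₀ q₁ q₂ step (suc zero)          = q₁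
ind3 Q q₀ q₁ q₂ step (suc (suc zero))    = q₂
ind3 Q q₀ q₁ q₂ step (suc (suc (suc n))) = step n (ind3 Q q₀ q₁ q₂ step n)

%3≡mod3 : ∀ n → n % 3 ≡ toℕ₃ (mod3 n)
%3≡mod3 = ind3 _ ≡.refl ≡.refl ≡.refl
  (λ n ih → ≡.trans (≡.cong (_% 3) (ℕP.+-comm 3 n))
                    (≡.trans ([m+n]%n≡m%n n 3) (≡.trans ih (≡.cong toℕ₃ (≡.sym (mod3-+3 n))))))
  where open import Data.Nat.DivMod using ([m+n]%n≡m%n)

bump : Mod3 → ℕ → ℕ
bump 1₃ q = suc q
bump _  q = q

⌊n+1/3⌋-suc : ∀ n → (suc n ℕ.+ 1) / 3 ≡ bump (mod3 n) ((n ℕ.+ 1) / 3)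
⌊n+1/3⌋-suc = ind3 _ ≡.refl ≡.refl ≡.refl step
  where
  open import Data.Nat.DivMod using (m/n≡1+[m∸n]/n)
  /3-+3 : ∀ m → (3 ℕ.+ m) / 3 ≡ suc (m / 3)
  /3-+3 m = m/n≡1+[m∸n]/n {3 ℕ.+ m} {3} (s≤s (s≤s (s≤s z≤n)))
  step : ∀ n → (suc n ℕ.+ 1) / 3 ≡ bump (mod3 n) ((n ℕ.+ 1) / 3) →
         (suc (3 ℕ.+ n) ℕ.+ 1) / 3 ≡ bump (mod3 (3 ℕ.+ n)) ((3 ℕ.+ n ℕ.+ 1) / 3)
  step n ih rewrite mod3-+3 n | /3-+3 (suc n ℕ.+ 1) | /3-+3 (n ℕ.+ 1) | ih with mod3 n
  ... | 0₃ = ≡.refl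
  ... | 1₃ = ≡.refl
  ... | 2₃ = ≡.refl

-- pvStep depends only on the residues and on the relative order: a valley (≡ 1) must lie
-- below its neighbour, a peak (≡ 2) above it
endOK : Mod3 → (below above : Bool) → Bool
endOK a below above = (not (toℕ₃ a == 1) ∨ below) ∧ (not (toℕ₃ a == 2) ∨ above)

stepOK : Mod3 → Mod3 → (x<y y<x : Bool) → Bool
stepOK a c x<y y<x = endOK a x<y y<x ∧ endOK c y<x x<y

pvStep≡stepOK : ∀ x y → pvStep x y ≡ stepOK (mod3 x) (mod3 y) (x <ᵇ y) (y <ᵇ x)
pvStep≡stepOK x y rewrite %3≡mod3 x | %3≡mod3 y = ≡.refl

pvStep-sym : ∀ x y → pvStep x y ≡ pvStep y x
pvStep-sym x y = ≡.trans (pvStep≡stepOK x y)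
  (≡.trans (BoolP.∧-comm (endOK (mod3 x) (x <ᵇ y) (y <ᵇ x)) _) (≡.sym (pvStep≡stepOK y x)))

mod3-3* : ∀ k → mod3 (3 ℕ.* k) ≡ 0₃
mod3-3* zero    = ≡.refl
mod3-3* (suc k) = ≡.trans (≡.cong mod3 (ℕP.*-suc 3 k)) (≡.trans (mod3-+3 (3 ℕ.* k)) (mod3-3* k))

-- 3k + 1 ≡ 1 (mod 3) is a valley, so it cannot follow or precede anything below it
pvStep-top : ∀ k y → y < suc (3 ℕ.* k) → pvStep (suc (3 ℕ.* k)) y ≡ false
pvStep-top k y y<D rewrite pvStep≡stepOK (suc (3 ℕ.* k)) y | mod3-3* k | <ᵇ-≮ (ℕP.<⇒≯ y<D) = ≡.refl

module PeakValleySums {c ℓ} (R : CommutativeRing c ℓ) where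
  open CommutativeRing R
  open Over R
  open FiniteSums R
  open import Relation.Binary.Reasoning.Setoid setoid

  pvSum : (K : ℕ) (V : ℕ → Carrier) → ℕ → ℕ → ℕ → Carrier
  pvSum K V m r s = sumR (map (wt V) (modPV K m r s))

  pvSum-zero : ∀ K V r s → pvSum K V 0 r s ≈ [ pvStep r s ]· 1#
  pvSum-zero K V r s rewrite isModPV-[] r s with pvStep r s
  ... | true  = +-identityʳ 1#
  ... | false = refl

  pvSum-suc : ∀ K V m r s → pvSum K V (suc m) r s ≈ ∑ (suc K) (λ a → [ pvStep r a ]· (V a * pvSum K V m a s))
  pvSum-suc K V m r s = trans (sumR-seqs-suc K m (wt V) (isModPV r s)) (∑-cong′ (suc K) first-entry)
    where
    first-entry : ∀ a → sumR (map (λ xs → V a * wt V xs) (filterᵇ (isModPV r s ∘ (a ∷_)) (seqs K m)))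
                        ≈ [ pvStep r a ]· (V a * pvSum K V m a s)
    first-entry a = begin
      sumR (map _ (filterᵇ (isModPV r s ∘ (a ∷_)) (seqs K m)))
        ≈⟨ sumR-filter-cong _ (isModPV-∷ r s a) (seqs K m) ⟩
      sumR (map _ (filterᵇ (λ xs → pvStep r a ∧ isModPV a s xs) (seqs K m)))
        ≈⟨ sumR-filter-∧ _ (pvStep r a) (isModPV a s) (seqs K m) ⟩
      [ pvStep r a ]· sumR (map (λ xs → V a * wt V xs) (filterᵇ (isModPV a s) (seqs K m)))
        ≈⟨ []·-cong (pvStep r a) (sym (*-distribˡ-sumR (V a) (wt V) (modPV K m a s))) ⟩
      [ pvStep r a ]· (V a * pvSum K V m a s) ∎

module AlternatingSigns {c ℓ} (R : CommutativeRing c ℓ) where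
  open CommutativeRing R
  open Over R
  open FiniteSums R
  open import Relation.Binary.Reasoning.Setoid setoid

  σ : ℕ → Carrier
  σ n = sign ((n ℕ.+ 1) / 3)

  flip : Mod3 → Carrier → Carrier
  flip 1₃ x = - x
  flip _  x = x

  σ-suc : ∀ n → σ (suc n) ≈ flip (mod3 n) (σ n)
  σ-suc n rewrite ⌊n+1/3⌋-suc n with mod3 n
  ... | 0₃ = refl
  ... | 1₃ = refl
  ... | 2₃ = refl

  -- the three entries of a column of J⁻¹ met by a row of J, up to a common factor
  threeTerms : (a c : Mod3) (l₀ g₀ l₁ g₁ l₂ g₂ : Bool) → Carrier → Carrier
  threeTerms a c l₀ g₀ l₁ g₁ l₂ g₂ s =
    [ stepOK a c l₀ g₀ ]· (- s) + [ stepOK (next a) c l₁ g₁ ]· flip a s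
    + [ stepOK (next (next a)) c l₂ g₂ ]· (- flip (next a) (flip a s))

  private
    0+0+0≈0 : 0# + 0# + 0# ≈ 0#
    0+0+0≈0 = trans (+-identityʳ _) (+-identityʳ _)

    -x+x+0≈0 : ∀ x → - x + x + 0# ≈ 0#
    -x+x+0≈0 x = trans (+-identityʳ _) (-‿inverseˡ x)

    -x+0+--x≈0 : ∀ x → - x + 0# + - (- x) ≈ 0#
    -x+0+--x≈0 x = trans (+-congʳ (+-identityʳ _)) (-‿inverseʳ (- x))

    0+-x+--x≈0 : ∀ x → 0# + - x + - (- x) ≈ 0#
    0+-x+--x≈0 x = trans (+-congʳ (+-identityˡ _)) (-‿inverseʳ (- x))

    0+x+-x≈0 : ∀ x → 0# + x + - x ≈ 0#
    0+x+-x≈0 x = trans (+-congʳ (+-identityˡ _)) (-‿inverseʳ x)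

    0+0+--x≈x : ∀ x → 0# + 0# + - (- x) ≈ x
    0+0+--x≈x x = trans (+-congʳ (+-identityˡ _)) (trans (+-identityˡ _) (-‿involutive x))

    -x+0+0≈-x : ∀ x → - x + 0# + 0# ≈ - x
    -x+0+0≈-x x = trans (+-identityʳ _) (+-identityʳ _)

    0+x+0≈x : ∀ x → 0# + x + 0# ≈ x
    0+x+0≈x x = trans (+-identityʳ _) (+-identityˡ _)

  threeTerms-before : ∀ a c s → threeTerms a c false true false true false true s ≈ 0#
  threeTerms-before 0₃ 0₃ s = -x+0+--x≈0 s
  threeTerms-before 0₃ 1₃ s = -x+0+--x≈0 s
  threeTerms-before 0₃ 2₃ s = 0+0+0≈0
  threeTerms-before 1₃ 0₃ s = 0+-x+--x≈0 s
  threeTerms-before 1₃ 1₃ s = 0+-x+--x≈0 s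
  threeTerms-before 1₃ 2₃ s = 0+0+0≈0
  threeTerms-before 2₃ 0₃ s = -x+x+0≈0 s
  threeTerms-before 2₃ 1₃ s = -x+x+0≈0 s
  threeTerms-before 2₃ 2₃ s = 0+0+0≈0

  threeTerms-at₀ : ∀ a s → threeTerms a a false false false true false true s ≈ 0#
  threeTerms-at₀ 0₃ s = -x+0+--x≈0 s
  threeTerms-at₀ 1₃ s = 0+-x+--x≈0 s
  threeTerms-at₀ 2₃ s = 0+0+0≈0

  threeTerms-at₁ : ∀ a s → threeTerms a (next a) true false false false false true s ≈ flip a s
  threeTerms-at₁ 0₃ s = 0+0+--x≈x s
  threeTerms-at₁ 1₃ s = -x+0+0≈-x s
  threeTerms-at₁ 2₃ s = 0+x+0≈x s

  threeTerms-at₂ : ∀ a s → threeTerms a (next (next a)) true false true false false false s ≈ 0#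
  threeTerms-at₂ 0₃ s = -x+x+0≈0 s
  threeTerms-at₂ 1₃ s = -x+0+--x≈0 s
  threeTerms-at₂ 2₃ s = 0+0+0≈0

  threeTerms-after : ∀ a c s → threeTerms a c true false true false true false s ≈ 0#
  threeTerms-after 0₃ 0₃ s = -x+x+0≈0 s
  threeTerms-after 0₃ 1₃ s = 0+0+0≈0
  threeTerms-after 0₃ 2₃ s = -x+x+0≈0 s
  threeTerms-after 1₃ 0₃ s = -x+0+--x≈0 s
  threeTerms-after 1₃ 1₃ s = 0+0+0≈0
  threeTerms-after 1₃ 2₃ s = -x+0+--x≈0 s
  threeTerms-after 2₃ 0₃ s = 0+x+-x≈0 s
  threeTerms-after 2₃ 1₃ s = 0+0+0≈0
  threeTerms-after 2₃ 2₃ s = 0+x+-x≈0 s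

  threeTerms-δ : ∀ x y →
    threeTerms (mod3 x) (mod3 y) (x <ᵇ y) (y <ᵇ x) (suc x <ᵇ y) (y <ᵇ suc x) (suc (suc x) <ᵇ y) (y <ᵇ suc (suc x)) (σ x)
      ≈ [ suc x == y ]· flip (mod3 x) (σ x)
  threeTerms-δ x y with ℕP.<-cmp y x
  ... | tri< y<x _ _
    rewrite <ᵇ-≮ (ℕP.<⇒≯ y<x) | <ᵇ-< y<x | <ᵇ-≮ (ℕP.<⇒≯ (ℕP.m<n⇒m<1+n y<x)) | <ᵇ-< (ℕP.m<n⇒m<1+n y<x)
          | <ᵇ-≮ (ℕP.<⇒≯ (ℕP.m<n⇒m<1+n (ℕP.m<n⇒m<1+n y<x))) | <ᵇ-< (ℕP.m<n⇒m<1+n (ℕP.m<n⇒m<1+n y<x))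
          | ==-≢ {suc x} {y} (λ sx≡y → ℕP.<-asym y<x (≡.subst (x <_) sx≡y (ℕP.n<1+n x)))
    = threeTerms-before (mod3 x) (mod3 y) (σ x)
  ... | tri≈ _ ≡.refl _
    rewrite <ᵇ-≮ (ℕP.n≮n x) | <ᵇ-≮ (ℕP.<⇒≯ (ℕP.n<1+n x)) | <ᵇ-< (ℕP.n<1+n x)
          | <ᵇ-≮ (ℕP.<⇒≯ (ℕP.m<n⇒m<1+n (ℕP.n<1+n x))) | <ᵇ-< (ℕP.m<n⇒m<1+n (ℕP.n<1+n x))
          | ==-≢ (ℕP.1+n≢n {x})
    = threeTerms-at₀ (mod3 x) (σ x)
  ... | tri> _ _ x<y with ℕP.<-cmp y (suc x)
  ...   | tri< y<sx _ _ = ⊥-elim (ℕP.<⇒≱ x<y (ℕP.≤-pred y<sx))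
  ...   | tri≈ _ ≡.refl _
    rewrite <ᵇ-< x<y | <ᵇ-≮ (ℕP.<⇒≯ x<y) | <ᵇ-≮ (ℕP.n≮n (suc x)) | ==-refl (suc x)
    = threeTerms-at₁ (mod3 x) (σ x)
  ...   | tri> _ _ sx<y with ℕP.<-cmp y (suc (suc x))
  ...     | tri< y<ssx _ _ = ⊥-elim (ℕP.<⇒≱ sx<y (ℕP.≤-pred y<ssx))
  ...     | tri≈ _ ≡.refl _
    rewrite <ᵇ-< x<y | <ᵇ-≮ (ℕP.<⇒≯ x<y) | <ᵇ-< sx<y | <ᵇ-≮ (ℕP.<⇒≯ sx<y) | <ᵇ-≮ (ℕP.n≮n (suc (suc x)))
          | ==-≢ {suc x} {suc (suc x)} (λ e → ℕP.1+n≢n (≡.sym e))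
    = threeTerms-at₂ (mod3 x) (σ x)
  ...     | tri> _ _ ssx<y
    rewrite <ᵇ-< x<y | <ᵇ-≮ (ℕP.<⇒≯ x<y) | <ᵇ-< sx<y | <ᵇ-≮ (ℕP.<⇒≯ sx<y)
          | <ᵇ-< ssx<y | <ᵇ-≮ (ℕP.<⇒≯ ssx<y)
          | ==-≢ {suc x} {y} (λ e → ℕP.<-irrefl e sx<y)
    = threeTerms-after (mod3 x) (mod3 y) (σ x)

  preceding : ℕ → ℕ → Carrier
  preceding zero    y = 0#
  preceding (suc x) y = [ pvStep x y ]· (- σ x)

  alternating-δ : ∀ x y → preceding x y + [ pvStep x y ]· σ x + [ pvStep (suc x) y ]· (- σ (suc x)) ≈ [ x == y ]· σ x
  alternating-δ zero zero                = threeTerms-at₁ 2₃ (σ 0)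
  alternating-δ zero (suc zero)          = threeTerms-at₂ 2₃ (σ 0)
  alternating-δ zero (suc (suc y))
    rewrite pvStep≡stepOK 0 (suc (suc y)) = threeTerms-after 2₃ (mod3 (suc (suc y))) (σ 0)
  alternating-δ (suc x) y
    rewrite pvStep≡stepOK x y | pvStep≡stepOK (suc x) y | pvStep≡stepOK (suc (suc x)) y = begin
      _ ≈⟨ +-cong (+-congˡ ([]·-cong _ (σ-suc x)))
                  ([]·-cong _ (-‿cong (trans (σ-suc (suc x)) (flip-cong (next (mod3 x)) (σ-suc x))))) ⟩
      _ ≈⟨ threeTerms-δ x y ⟩
      _ ≈⟨ []·-cong (suc x == y) (sym (σ-suc x)) ⟩
      [ suc x == y ]· σ (suc x) ∎
    where
    flip-cong : ∀ a {u v} → u ≈ v → flip a u ≈ flip a v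
    flip-cong 0₃ u≈v = u≈v
    flip-cong 1₃ u≈v = -‿cong u≈v
    flip-cong 2₃ u≈v = u≈v

-- The inverse of the Jacobi matrix

module PeakValleyInverse {c ℓ} (R : CommutativeRing c ℓ) (k : ℕ) (V W : ℕ → CommutativeRing.Carrier R)
                         (VW : FiniteSums.PointwiseInverse R V W) where
  open CommutativeRing R
  open Over R
  open FiniteSums R
  open PeakValleySums R
  open AlternatingSigns R
  open import Relation.Binary.Reasoning.Setoid setoid
  open import Algebra.Solver.CommutativeMonoid *-commutativeMonoid
    using () renaming (solve to *-solve; _⊜_ to _⊜*_; _⊕_ to _·*_)
  open import Algebra.Solver.CommutativeMonoid +-commutativeMonoid
    using () renaming (solve to +-solve; _⊜_ to _⊜₊_; _⊕_ to _⊕₊_)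

  K : ℕ
  K = 3 ℕ.* k

  b lam : ℕ → Carrier
  b i   = - W i
  lam i = W i * W (i ∸ 1)

  open Jacobi R (suc K) b lam public

  Pv Pw : ℕ → Carrier
  Pv = prodUpTo V
  Pw = prodUpTo W

  Pv-suc : ∀ n → Pv (suc n) ≈ Pv n * V n
  Pv-suc n = trans (≡⇒≈ (prodUpTo≡∏ V (suc n))) (trans (∏-last n V) (*-congʳ (≡⇒≈ (≡.sym (prodUpTo≡∏ V n)))))

  Pw-suc : ∀ n → Pw (suc n) ≈ Pw n * W n
  Pw-suc n = trans (≡⇒≈ (prodUpTo≡∏ W (suc n))) (trans (∏-last n W) (*-congʳ (≡⇒≈ (≡.sym (prodUpTo≡∏ W n)))))

  Pv*Pw : ∀ n → Pv n * Pw n ≈ 1#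
  Pv*Pw n = trans (≡⇒≈ (≡.cong₂ _*_ (prodUpTo≡∏ V n) (prodUpTo≡∏ W n))) (∏-inverse n V W VW)

  e : ℕ → ℕ
  e n = (n ℕ.+ 1) / 3

  U : Matrix
  U x y = [ pvStep x y ]· (sign (suc (e x ℕ.+ e y)) * (Pv (suc y) * Pw x))

  U-sign : ∀ x y → sign (suc (e x ℕ.+ e y)) ≈ - (σ x * σ y)
  U-sign x y = -‿cong (sign-+ (e x) (e y))

  on-diagonal : ∀ x y c → (x ≡ y → c * σ x ≈ 1#) → c * [ x == y ]· σ x ≈ δ x y
  on-diagonal x y c diag with x == y in eq
  ... | true  = diag (==⇒≡ x y eq)
  ... | false = zeroʳ c

  σ²Pv*Pw : ∀ n m → σ n * (Pv m * Pw m) * σ n ≈ 1#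
  σ²Pv*Pw n m = trans (*-solve 3 (λ s p q → ((s ·* (p ·* q)) ·* s) ⊜* ((s ·* s) ·* (p ·* q))) refl (σ n) (Pv m) (Pw m))
                      (trans (*-cong (sign-*-sign (e n)) (Pv*Pw m)) (*-identityˡ 1#))

  private
    -‿*-‿ : ∀ x y → - x * - y ≈ x * y
    -‿*-‿ x y = trans (sym (-‿distribˡ-* x (- y))) (trans (-‿cong (sym (-‿distribʳ-* x y))) (-‿involutive _))

    move-neg : ∀ x y z → - (x * y) * z ≈ (y * z) * - x
    move-neg x y z = trans (sym (-‿distribˡ-* _ _))
      (trans (-‿cong (*-solve 3 (λ x y z → ((x ·* y) ·* z) ⊜* ((y ·* z) ·* x)) refl x y z)) (-‿distribʳ-* _ _))

    move-neg′ : ∀ x y z → - (x * y) * z ≈ (x * z) * - y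
    move-neg′ x y z = trans (*-congʳ (-‿cong (*-comm x y))) (move-neg y x z)

    *-by-1 : ∀ a {x} → x ≈ 1# → a * x ≈ a
    *-by-1 a x≈1 = trans (*-congˡ x≈1) (*-identityʳ a)

  cut-top : ∀ x y → x < suc K → y < suc K → [ suc x <ᵇ suc K ]· U (suc x) y ≈ U (suc x) y
  cut-top x y x<D y<D with suc x ℕ.<? suc K
  ... | yes sx<D = ≡⇒≈ (≡.cong ([_]· U (suc x) y) (<ᵇ-< sx<D))
  ... | no  sx≮D with ≡.refl ← ℕP.suc-injective (ℕP.≤-antisym x<D (ℕP.≮⇒≥ sx≮D))
    rewrite <ᵇ-≮ sx≮D | pvStep-top k y y<D = refl

  -- Row x of J meets column y of U in three terms, each κ times a term of alternating-δ x y.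
  J·U : IsInverse J U
  J·U x y x<D y<D = begin
    ∑ (suc K) (λ a → J x a * U a y)
      ≈⟨ J-row x (λ a → U a y) x<D ⟩
    [ suc x <ᵇ suc K ]· U (suc x) y + b x * U x y + below x (λ a → U a y)
      ≈⟨ +-cong (+-cong (trans (cut-top x y x<D y<D) next-row) this-row) (previous-row x) ⟩
    κ * [ pvStep (suc x) y ]· (- σ (suc x)) + κ * [ pvStep x y ]· σ x + κ * preceding x y
      ≈⟨ trans (+-solve 3 (λ a b d → ((a ⊕₊ b) ⊕₊ d) ⊜₊ ((d ⊕₊ b) ⊕₊ a)) refl _ _ _)
               (sym (trans (distribˡ κ _ _) (+-congʳ (distribˡ κ _ _)))) ⟩
    κ * (preceding x y + [ pvStep x y ]· σ x + [ pvStep (suc x) y ]· (- σ (suc x)))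
      ≈⟨ *-congˡ (alternating-δ x y) ⟩
    κ * [ x == y ]· σ x
      ≈⟨ on-diagonal x y κ (λ { ≡.refl → σ²Pv*Pw x (suc x) }) ⟩
    δ x y ∎
    where
    κ : Carrier
    κ = σ y * (Pv (suc y) * Pw (suc x))
    next-row : U (suc x) y ≈ κ * [ pvStep (suc x) y ]· (- σ (suc x))
    next-row = trans ([]·-cong (pvStep (suc x) y) (trans (*-congʳ (U-sign (suc x) y)) (move-neg _ _ _)))
                     (sym (*-[]· _ κ _))
    this-row : b x * U x y ≈ κ * [ pvStep x y ]· σ x
    this-row = trans (*-[]· (pvStep x y) _ _) (trans ([]·-cong (pvStep x y) (begin
      - W x * (sign (suc (e x ℕ.+ e y)) * (Pv (suc y) * Pw x))
        ≈⟨ trans (*-congˡ (trans (*-congʳ (U-sign x y)) (sym (-‿distribˡ-* _ _)))) (-‿*-‿ _ _) ⟩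
      W x * ((σ x * σ y) * (Pv (suc y) * Pw x))
        ≈⟨ *-solve 5 (λ w s t p q → (w ·* ((s ·* t) ·* (p ·* q))) ⊜* ((t ·* (p ·* (q ·* w))) ·* s)) refl _ _ _ _ _ ⟩
      σ y * (Pv (suc y) * (Pw x * W x)) * σ x
        ≈⟨ *-congʳ (*-congˡ (*-congˡ (sym (Pw-suc x)))) ⟩
      κ * σ x ∎)) (sym (*-[]· _ κ _)))
    previous-row : ∀ x → below x (λ a → U a y) ≈ σ y * (Pv (suc y) * Pw (suc x)) * preceding x y
    previous-row zero    = sym (zeroʳ _)
    previous-row (suc x) = trans (*-[]· (pvStep x y) _ _) (trans ([]·-cong (pvStep x y) (begin
      W (suc x) * W x * (sign (suc (e x ℕ.+ e y)) * (Pv (suc y) * Pw x))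
        ≈⟨ *-congˡ (trans (*-congʳ (U-sign x y)) (move-neg _ _ _)) ⟩
      W (suc x) * W x * ((σ y * (Pv (suc y) * Pw x)) * - σ x)
        ≈⟨ *-solve 6 (λ w₁ w₀ t p q m → ((w₁ ·* w₀) ·* ((t ·* (p ·* q)) ·* m))
                                      ⊜* ((t ·* (p ·* ((q ·* w₀) ·* w₁))) ·* m)) refl _ _ _ _ _ _ ⟩
      σ y * (Pv (suc y) * (Pw x * W x * W (suc x))) * - σ x
        ≈⟨ *-congʳ (*-congˡ (*-congˡ (sym (trans (Pw-suc (suc x)) (*-congʳ (Pw-suc x)))))) ⟩
      σ y * (Pv (suc y) * Pw (suc (suc x))) * - σ x ∎)) (sym (*-[]· _ _ _)))

  cut-top′ : ∀ x y → x < suc K → y < suc K →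
             [ suc y <ᵇ suc K ]· (U x (suc y) * lam (suc y)) ≈ U x (suc y) * lam (suc y)
  cut-top′ x y x<D y<D with suc y ℕ.<? suc K
  ... | yes sy<D = ≡⇒≈ (≡.cong ([_]· (U x (suc y) * lam (suc y))) (<ᵇ-< sy<D))
  ... | no  sy≮D with ≡.refl ← ℕP.suc-injective (ℕP.≤-antisym y<D (ℕP.≮⇒≥ sy≮D))
    rewrite <ᵇ-≮ sy≮D | pvStep-sym x (suc K) | pvStep-top k x x<D = sym (zeroˡ _)

  U·J : IsInverse U J
  U·J x y x<D y<D = begin
    ∑ (suc K) (λ a → U x a * J a y)
      ≈⟨ J-column y (U x) y<D ⟩
    above y (U x) + U x y * b y + [ suc y <ᵇ suc K ]· (U x (suc y) * lam (suc y))
      ≈⟨ +-cong (+-cong (previous-column y) this-column) (trans (cut-top′ x y x<D y<D) next-column) ⟩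
    κ * preceding y x + κ * [ pvStep y x ]· σ y + κ * [ pvStep (suc y) x ]· (- σ (suc y))
      ≈⟨ sym (trans (distribˡ κ _ _) (+-congʳ (distribˡ κ _ _))) ⟩
    κ * (preceding y x + [ pvStep y x ]· σ y + [ pvStep (suc y) x ]· (- σ (suc y)))
      ≈⟨ *-congˡ (alternating-δ y x) ⟩
    κ * [ y == x ]· σ y
      ≈⟨ on-diagonal y x κ (λ { ≡.refl → σ²Pv*Pw y y }) ⟩
    δ y x
      ≈⟨ δ-sym y x ⟩
    δ x y ∎
    where
    κ : Carrier
    κ = σ x * (Pv y * Pw x)
    previous-column : ∀ y → above y (U x) ≈ σ x * (Pv y * Pw x) * preceding y x
    previous-column zero    = sym (zeroʳ _)
    previous-column (suc y) rewrite pvStep-sym x y =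
      trans ([]·-cong (pvStep y x) (trans (*-congʳ (U-sign x y)) (move-neg′ _ _ _))) (sym (*-[]· _ _ _))
    this-column : U x y * b y ≈ κ * [ pvStep y x ]· σ y
    this-column rewrite pvStep-sym x y = trans ([]·-* (pvStep y x) _ _) (trans ([]·-cong (pvStep y x) (begin
      sign (suc (e x ℕ.+ e y)) * (Pv (suc y) * Pw x) * - W y
        ≈⟨ trans (*-congʳ (trans (*-congʳ (U-sign x y)) (sym (-‿distribˡ-* _ _)))) (-‿*-‿ _ _) ⟩
      σ x * σ y * (Pv (suc y) * Pw x) * W y
        ≈⟨ trans (*-congʳ (*-congˡ (*-congʳ (Pv-suc y))))
                 (*-solve 6 (λ s t p v q w → (((s ·* t) ·* ((p ·* v) ·* q)) ·* w)
                                          ⊜* (((s ·* (p ·* q)) ·* t) ·* (v ·* w))) refl _ _ _ _ _ _) ⟩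
      σ x * (Pv y * Pw x) * σ y * (V y * W y)
        ≈⟨ *-by-1 _ (VW y) ⟩
      κ * σ y ∎)) (sym (*-[]· _ κ _)))
    next-column : U x (suc y) * lam (suc y) ≈ κ * [ pvStep (suc y) x ]· (- σ (suc y))
    next-column rewrite pvStep-sym x (suc y) = trans ([]·-* (pvStep (suc y) x) _ _) (trans ([]·-cong (pvStep (suc y) x) (begin
      sign (suc (e x ℕ.+ e (suc y))) * (Pv (suc (suc y)) * Pw x) * (W (suc y) * W y)
        ≈⟨ *-congʳ (trans (*-congʳ (U-sign x (suc y))) (move-neg′ _ _ _)) ⟩
      σ x * (Pv (suc (suc y)) * Pw x) * - σ (suc y) * (W (suc y) * W y)
        ≈⟨ *-congʳ (*-congʳ (*-congˡ (*-congʳ (trans (Pv-suc (suc y)) (*-congʳ (Pv-suc y)))))) ⟩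
      σ x * (Pv y * V y * V (suc y) * Pw x) * - σ (suc y) * (W (suc y) * W y)
        ≈⟨ *-solve 8 (λ s p v₀ v₁ q m w₁ w₀ → (((s ·* (((p ·* v₀) ·* v₁) ·* q)) ·* m) ·* (w₁ ·* w₀))
                                          ⊜* ((((s ·* (p ·* q)) ·* m) ·* (v₀ ·* w₀)) ·* (v₁ ·* w₁))) refl _ _ _ _ _ _ _ _ ⟩
      σ x * (Pv y * Pw x) * - σ (suc y) * (V y * W y) * (V (suc y) * W (suc y))
        ≈⟨ trans (*-by-1 _ (VW (suc y))) (*-by-1 _ (VW y)) ⟩
      κ * - σ (suc y) ∎)) (sym (*-[]· _ κ _)))

  U-power-factor : ℕ → ℕ → ℕ → Carrier
  U-power-factor n r s = sign (e r ℕ.+ e s ℕ.+ suc n) * (Pv (suc s) * Pw r)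

  U-power : ∀ n r s → s < suc K → (U ^ suc n · unit s) r ≈ U-power-factor n r s * pvSum K V n r s
  U-power zero r s s<D = begin
    (U · unit s) r                                           ≈⟨ ·-unit U s r s<D ⟩
    [ pvStep r s ]· (sign (suc (e r ℕ.+ e s)) * (Pv (suc s) * Pw r))
      ≈⟨ []·-cong (pvStep r s) (trans (*-congʳ (≡⇒≈ (≡.cong sign (ℕP.+-comm 1 (e r ℕ.+ e s)))))
                                      (sym (*-identityʳ _))) ⟩
    [ pvStep r s ]· (U-power-factor 0 r s * 1#)              ≈⟨ sym (*-[]· (pvStep r s) _ 1#) ⟩
    U-power-factor 0 r s * [ pvStep r s ]· 1#                ≈⟨ *-congˡ (sym (pvSum-zero K V r s)) ⟩
    U-power-factor 0 r s * pvSum K V 0 r s                   ∎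
  U-power (suc n) r s s<D = begin
    ∑ (suc K) (λ a → U r a * (U ^ suc n · unit s) a)
      ≈⟨ ∑-cong′ (suc K) (λ a → trans (*-congˡ (U-power n a s s<D)) (step a)) ⟩
    ∑ (suc K) (λ a → U-power-factor (suc n) r s * [ pvStep r a ]· (V a * pvSum K V n a s))
      ≈⟨ sym (*-distribˡ-∑ (suc K) (U-power-factor (suc n) r s) (λ a → [ pvStep r a ]· (V a * pvSum K V n a s))) ⟩
    U-power-factor (suc n) r s * ∑ (suc K) (λ a → [ pvStep r a ]· (V a * pvSum K V n a s))
      ≈⟨ *-congˡ (sym (pvSum-suc K V n r s)) ⟩
    U-power-factor (suc n) r s * pvSum K V (suc n) r s ∎
    where
    step : ∀ a → U r a * (U-power-factor n a s * pvSum K V n a s)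
                 ≈ U-power-factor (suc n) r s * [ pvStep r a ]· (V a * pvSum K V n a s)
    step a = trans ([]·-* (pvStep r a) _ _) (trans ([]·-cong (pvStep r a) (begin
      sign (suc (e r ℕ.+ e a)) * (Pv (suc a) * Pw r) * (sign (e a ℕ.+ e s ℕ.+ suc n) * (Pv (suc s) * Pw a) * pvSum K V n a s)
        ≈⟨ *-solve 7 (λ σ₁ p w σ₂ p′ w′ G → ((σ₁ ·* (p ·* w)) ·* ((σ₂ ·* (p′ ·* w′)) ·* G))
                                        ⊜* (((σ₁ ·* σ₂) ·* (p′ ·* w)) ·* ((p ·* w′) ·* G))) refl _ _ _ _ _ _ _ ⟩
      sign (suc (e r ℕ.+ e a)) * sign (e a ℕ.+ e s ℕ.+ suc n) * (Pv (suc s) * Pw r) * (Pv (suc a) * Pw a * pvSum K V n a s)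
        ≈⟨ *-cong (*-congʳ signs) (*-congʳ Pv-suc*Pw) ⟩
      U-power-factor (suc n) r s * (V a * pvSum K V n a s) ∎)) (sym (*-[]· _ _ _)))
      where
      Pv-suc*Pw : Pv (suc a) * Pw a ≈ V a
      Pv-suc*Pw = trans (*-congʳ (Pv-suc a))
                        (trans (*-solve 3 (λ p v w → ((p ·* v) ·* w) ⊜* (v ·* (p ·* w))) refl _ _ _) (*-by-1 _ (Pv*Pw a)))
      signs : sign (suc (e r ℕ.+ e a)) * sign (e a ℕ.+ e s ℕ.+ suc n) ≈ sign (e r ℕ.+ e s ℕ.+ suc (suc n))
      signs = trans (sym (sign-+ (suc (e r ℕ.+ e a)) _)) (trans (≡⇒≈ (≡.cong sign (exponents (e r) (e a) (e s) n)))
                                                             (sign-+-double (e r ℕ.+ e s ℕ.+ suc (suc n)) (e a)))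

  P-at-0-step : ∀ j → P (suc (suc j)) 0 ≈ W j * P (suc j) 0 + - lam j * P j 0
  P-at-0-step j = trans (+-congʳ (+-identityˡ _)) (+-congʳ (*-congʳ (-‿involutive _)))

  P-at-0 : ∀ m → P (suc (m ℕ.* 3)) 0 ≈ sign m * Pw (m ℕ.* 3)
               × P (suc (suc (m ℕ.* 3))) 0 ≈ sign m * Pw (suc (m ℕ.* 3))
               × P (suc (suc (suc (m ℕ.* 3)))) 0 ≈ 0#
  P-at-0 zero = sym (*-identityˡ _) , second , third
    where
    second : P 2 0 ≈ 1# * Pw 1
    second = trans (P-at-0-step 0) (trans (+-cong (*-identityʳ _) (zeroʳ _))
                   (trans (+-identityʳ _) (sym (trans (*-identityˡ _) (trans (Pw-suc 0) (*-identityˡ _))))))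
    third : P 3 0 ≈ 0#
    third = trans (P-at-0-step 1) (cancels (W 1) (W 0) (trans second (*-congˡ (trans (Pw-suc 0) (*-identityˡ _)))) refl)
      where
      cancels : ∀ w₁ w₀ {x₁ x₀} → x₁ ≈ 1# * w₀ → x₀ ≈ 1# → w₁ * x₁ + - (w₁ * w₀) * x₀ ≈ 0#
      cancels w₁ w₀ x₁≈ x₀≈ =
        trans (+-cong (*-congˡ (trans x₁≈ (*-identityˡ _))) (trans (*-congˡ x₀≈) (*-identityʳ _))) (-‿inverseʳ _)
  P-at-0 (suc m) = first , second , third
    where
    t = m ℕ.* 3
    ih = P-at-0 m
    first : P (suc (3 ℕ.+ t)) 0 ≈ sign (suc m) * Pw (3 ℕ.+ t)
    first = begin
      P (suc (3 ℕ.+ t)) 0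
        ≈⟨ trans (P-at-0-step (suc (suc t)))
                 (+-cong (trans (*-congˡ (proj₂ (proj₂ ih))) (zeroʳ _)) (*-congˡ (proj₁ (proj₂ ih)))) ⟩
      0# + - (W (suc (suc t)) * W (suc t)) * (sign m * Pw (suc t))
        ≈⟨ trans (+-identityˡ _) (trans (sym (-‿distribˡ-* _ _)) (-‿cong
                 (*-solve 4 (λ a b s p → ((a ·* b) ·* (s ·* p)) ⊜* (s ·* ((p ·* b) ·* a))) refl _ _ _ _))) ⟩
      - (sign m * (Pw (suc t) * W (suc t) * W (suc (suc t))))
        ≈⟨ -‿distribˡ-* _ _ ⟩
      sign (suc m) * (Pw (suc t) * W (suc t) * W (suc (suc t)))
        ≈⟨ *-congˡ (sym (trans (Pw-suc (suc (suc t))) (*-congʳ (Pw-suc (suc t))))) ⟩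
      sign (suc m) * Pw (3 ℕ.+ t) ∎
    second : P (suc (suc (3 ℕ.+ t))) 0 ≈ sign (suc m) * Pw (suc (3 ℕ.+ t))
    second = begin
      P (suc (suc (3 ℕ.+ t))) 0
        ≈⟨ trans (P-at-0-step (3 ℕ.+ t)) (+-cong (*-congˡ first) (trans (*-congˡ (proj₂ (proj₂ ih))) (zeroʳ _))) ⟩
      W (3 ℕ.+ t) * (sign (suc m) * Pw (3 ℕ.+ t)) + 0#
        ≈⟨ trans (+-identityʳ _) (*-solve 3 (λ w s p → (w ·* (s ·* p)) ⊜* (s ·* (p ·* w))) refl _ _ _) ⟩
      sign (suc m) * (Pw (3 ℕ.+ t) * W (3 ℕ.+ t))
        ≈⟨ *-congˡ (sym (Pw-suc (3 ℕ.+ t))) ⟩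
      sign (suc m) * Pw (suc (3 ℕ.+ t)) ∎
    third : P (suc (suc (suc (3 ℕ.+ t)))) 0 ≈ 0#
    third = begin
      P (suc (suc (suc (3 ℕ.+ t)))) 0
        ≈⟨ trans (P-at-0-step (suc (3 ℕ.+ t)))
                 (+-cong (*-congˡ second) (trans (sym (-‿distribˡ-* _ _)) (-‿cong (*-congˡ first)))) ⟩
      W (suc (3 ℕ.+ t)) * (sign (suc m) * Pw (suc (3 ℕ.+ t)))
        + - (W (suc (3 ℕ.+ t)) * W (3 ℕ.+ t) * (sign (suc m) * Pw (3 ℕ.+ t)))
        ≈⟨ +-congˡ (-‿cong (trans (*-solve 4 (λ a b s p → ((a ·* b) ·* (s ·* p)) ⊜* (a ·* (s ·* (p ·* b)))) refl _ _ _ _)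
                                  (*-congˡ (*-congˡ (sym (Pw-suc (3 ℕ.+ t))))))) ⟩
      W (suc (3 ℕ.+ t)) * (sign (suc m) * Pw (suc (3 ℕ.+ t))) + - (W (suc (3 ℕ.+ t)) * (sign (suc m) * Pw (suc (3 ℕ.+ t))))
        ≈⟨ -‿inverseʳ _ ⟩
      0# ∎

  subst-K : ∀ {p} (Q : ℕ → Set p) → Q (k ℕ.* 3) → Q K
  subst-K Q = ≡.subst Q (ℕP.*-comm k 3)

  last-coefficient-inverse : - P (suc (suc K)) (suc K ∸ suc K) * - (sign k * Pv (suc K)) ≈ 1#
  last-coefficient-inverse = begin
    - P (suc (suc K)) (suc K ∸ suc K) * - (sign k * Pv (suc K))
      ≈⟨ trans (-‿*-‿ _ _) (*-congʳ (≡⇒≈ (≡.cong (P (suc (suc K))) (ℕP.n∸n≡0 K)))) ⟩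
    P (suc (suc K)) 0 * (sign k * Pv (suc K))
      ≈⟨ *-congʳ (subst-K (λ n → P (suc (suc n)) 0 ≈ sign k * Pw (suc n)) (proj₁ (proj₂ (P-at-0 k)))) ⟩
    sign k * Pw (suc K) * (sign k * Pv (suc K))
      ≈⟨ *-solve 3 (λ s w v → ((s ·* w) ·* (s ·* v)) ⊜* ((s ·* s) ·* (v ·* w))) refl _ _ _ ⟩
    sign k * sign k * (Pv (suc K) * Pw (suc K))
      ≈⟨ trans (*-cong (sign-*-sign k) (Pv*Pw (suc K))) (*-identityˡ 1#) ⟩
    1# ∎

  lam⁻¹ : ℕ → Carrier
  lam⁻¹ i = V i * V (i ∸ 1)

  lam⁻¹-inverse : ∀ i → lam⁻¹ i * lam i ≈ 1#
  lam⁻¹-inverse i = trans (interchange _ _ _ _) (trans (*-cong (VW i) (VW (i ∸ 1))) (*-identityˡ 1#))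
    where open import Algebra.Properties.CommutativeSemigroup *-commutativeSemigroup using (interchange)

  open CayleyHamilton U J·U U·J lam⁻¹ lam⁻¹-inverse public

theorem5p8 : ∀ {c ℓ} (F : Field c ℓ) →
    let open Field F using (commRing) in
    let open CommutativeRing commRing in
    let open Over commRing in
    (V W : ℕ → Carrier) → (∀ i → V i * W i ≈ 1#) →
    (k n r s : ℕ) → 1 ≤ k → 1 ≤ n → r ≤ 3 ℕ.* k → s ≤ 3 ℕ.* k →
    let b : ℕ → Carrier
        b i = - W i
        lam : ℕ → Carrier
        lam i = W i * W (i ∸ 1)
        f : ℕ → Carrier
        f N = mu (3 ℕ.* k) b lam N r s
        rhs : Carrier
        rhs = sign ((r ℕ.+ 1) ℕ./ 3 ℕ.+ (s ℕ.+ 1) ℕ./ 3 ℕ.+ n)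
              * (prodUpTo V (suc s) * prodUpTo W r)
              * sumR (map (wt V) (modPV (3 ℕ.* k) (n ∸ 1) r s))
    in Σ (ℤ → Carrier) (IsExtension f)
       × ((g : ℤ → Carrier) → IsExtension f g → g (ℤ.- (ℤ.+ n)) ≈ rhs)
theorem5p8 F V W VW k zero    r s _ () r≤K s≤K
theorem5p8 F V W VW k (suc n) r s _ _  r≤K s≤K =
  (g , g-extends-μ , suc K , cs , s≤s z≤n , cs≉0 , g-recurrent) , g′-at-−n
  where
  open Field F using (commRing; 1≉0; inverse)
  open CommutativeRing commRing
  open Over commRing
  open PeakValleyInverse commRing k V W VW
  open PeakValleySums commRing using (pvSum)
  open MotzkinPaths commRing K b lam using (mu≈J-power)
  open Recurrences commRing using (extension-unique)

  g : ℤ → Carrier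
  g N = Y s N r

  g-extends-μ : ∀ N → g (ℤ.+ N) ≈ mu K b lam N r s
  g-extends-μ N = sym (mu≈J-power N r s (s≤s r≤K))

  cs : ℕ → Carrier
  cs t = - P (suc (suc K)) (suc K ∸ t)

  g-recurrent : ∀ N → g N ≈ recSum g cs N (suc K)
  g-recurrent = Y-recurrent s r (s≤s s≤K) (s≤s r≤K)

  cs≉0 : ¬ (cs (suc K) ≈ 0#)
  cs≉0 cs≈0 = 1≉0 (trans (sym last-coefficient-inverse) (trans (*-congʳ cs≈0) (zeroˡ _)))

  g′-at-−n : ∀ g′ → IsExtension (λ N → mu K b lam N r s) g′ → g′ ℤ.-[1+ n ] ≈ U-power-factor n r s * pvSum K V n r s
  g′-at-−n g′ (g′-extends-μ , zero    , cs′ , () , _)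
  g′-at-−n g′ (g′-extends-μ , suc d′ , cs′ , _ , cs′≉0 , g′-recurrent) =
    trans (extension-unique _ (proj₁ (inverse _ cs′≉0)) g-recurrent last-coefficient-inverse
                            g′-recurrent (proj₂ (inverse _ cs′≉0))
                            (λ u → trans (g-extends-μ u) (sym (g′-extends-μ u))) ℤ.-[1+ n ])
          (U-power n r s (s≤s s≤K))
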